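{- Algorithm VT$'$ is $c^*(\mathcal{P})$-competitive: for every $T\ge1$ and every sequence $(V_1,\ldots,V_T)\in\{r^{(0)},\ldots,r^{(m)}\}^T$, $\mathbb{E}[\mathsf{ALG}(V_1,\ldots,V_T)]\ge c^*(\mathcal{P})\,\mathsf{OPT}(V_1,\ldots,V_T)$.
   Context: Setting (single-item dynamic pricing, public pricing, deterministic valuations). Fix $m\ge1$, prices $0<r^{(1)}<\cdots<r^{(m)}$, $\mathcal{P}=\{r^{(1)},\ldots,r^{(m)}\}$, $r^{(0)}=0$, $r^{(m+1)}=\infty$, inventory $k\ge1$. Customers $t=1,\ldots,T$ ($T$ unknown) have valuations $V_t\in\{r^{(0)},\ldots,r^{(m)}\}$; an online algorithm chooses a (possibly random) price $P_t\in\{r^{(1)},\ldots,r^{(m+1)}\}$ using only past prices and valuations, and must set $P_t=\infty$ if no inventory remains; $X_t=\mathbb{1}(V_t\ge P_t)$; $\mathsf{ALG}=\sum_tP_tX_t$; $I_t=k-\sum_{t'\le t}X_{t'}$. $\mathsf{OPT}(V_1,\ldots,V_T)$ is the sum of the $\min\{k,T\}$ largest valuations. Let $q^{(j)}=1-r^{(j-1)}/r^{(j)}$, $q=\sum_jq^{(j)}$, $c^*(\mathcal{P})=1/q$. Algorithm VT: initialize $\mathtt{level}[i]=0$, $\mathtt{sold}[i]=\mathtt{false}$ for $i=1,\ldots,k$. For each customer $t$: let $i^*_t$ minimize $\mathtt{level}[i]$ (fixed deterministic tie-breaking), and $\ell_t$ satisfy $\mathtt{level}[i^*_t]=r^{(\ell_t)}$.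 If $\mathtt{sold}[i^*_t]=\mathtt{false}$, choose price $r^{(j)}$, $j\in\{\ell_t+1,\ldots,m\}$, w.p. $q^{(j)}/\sum_{j'=\ell_t+1}^mq^{(j')}$; else price $\infty$. Then observe $V_t,X_t$, set $\mathtt{level}[i^*_t]=\max\{\mathtt{level}[i^*_t],V_t\}$, and if $X_t=1$ set $\mathtt{sold}[i^*_t]=\mathtt{true}$. Algorithm VT$'$: at time $t$, with its own remaining inventory $I_{t-1}$, compute $i^*_t,\ell_t$ as in Algorithm VT from $V_1,\ldots,V_{t-1}$; let $\gamma_t$ be the probability that $\mathtt{sold}[i^*_t]=\mathtt{true}$ in a run of Algorithm VT conditioned on that run having $I_{t-1}$ units remaining at the end of time $t-1$. With probability $1-\gamma_t$ offer a price drawn from the distribution Algorithm VT uses when $\mathtt{sold}[i^*_t]=\mathtt{false}$; with probability $\gamma_t$ offer $\infty$.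
   Formalization: The prices $r^{(1)},\ldots,r^{(m)}$ of the grid $\mathcal{P}$ are rational. -}

module Defs where

open import Data.Bool using (Bool; true; false; if_then_else_; _∧_; not)
open import Data.Nat as ℕ using (ℕ; zero; suc; _∸_; _<ᵇ_; _≡ᵇ_; _⊔_)
open import Data.Fin using (Fin; toℕ)
open import Data.List as List using (List; []; _∷_; map; concatMap; foldl; foldr; upTo; take; reverse; null)
open import Data.Vec as Vec using (Vec)
open import Data.Product using (_×_; _,_; proj₁; proj₂)
open import Data.Rational as ℚ using (ℚ; 0ℚ; 1ℚ; _+_; _*_; _-_; _<_)
open import Data.Rational.Properties as ℚP using (≤-decTotalOrder)
open import Relation.Binary.PropositionalEquality using (_≡_)
open import Relation.Nullary using (yes; no; does)

open import Data.List.Sort ≤-decTotalOrder using (sort)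

-- Division with the convention x ÷? 0 = 0 (only used where the
-- denominator is a probability / a positive quantity).
_÷?_ : ℚ → ℚ → ℚ
p ÷? d with d ℚ.≟ 0ℚ
... | yes _  = 0ℚ
... | no d≢0 = ℚ._÷_ p d {{ℚ.≢-nonZero d≢0}}

sumℚ : List ℚ → ℚ
sumℚ = foldr _+_ 0ℚ

-- Price grid.  A price vector is r : ℕ → ℚ, r j = r^{(j)}; only
-- indices 0..m matter.  r^{(m+1)} = ∞ is represented by "no offer".

ValidPrices : ℕ → (ℕ → ℚ) → Set
ValidPrices m r = (r 0 ≡ 0ℚ) × (∀ j → j ℕ.< m → r j < r (suc j))

qj : (ℕ → ℚ) → ℕ → ℚ
qj r j = 1ℚ - (r (j ∸ 1) ÷? r j)

indicesAbove : ℕ → ℕ → List ℕ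
indicesAbove m ℓ = map (λ i → suc (ℓ ℕ.+ i)) (upTo (m ∸ ℓ))

qtot : ℕ → (ℕ → ℚ) → ℚ
qtot m r = sumℚ (map (qj r) (indicesAbove m 0))

cstar : ℕ → (ℕ → ℚ) → ℚ
cstar m r = 1ℚ ÷? qtot m r

-- distribution of VT's price when the minimal level is r^{(ℓ)}:
-- r^{(j)}, j ∈ {ℓ+1..m}, with prob. q^{(j)} / Σ_{j'=ℓ+1}^m q^{(j')}
priceDist : ℕ → (ℕ → ℚ) → ℕ → List (ℚ × ℕ)
priceDist m r ℓ =
  map (λ j → (qj r j ÷? sumℚ (map (qj r) (indicesAbove m ℓ))) , j)
      (indicesAbove m ℓ)

sells : (ℕ → ℚ) → ℕ → ℕ → Bool
sells r v j = does (r j ℚ.≤? r v)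

-- Levels (stored as indices: level[i] = r^{(lev i)}), slots 0..k-1

update : {A : Set} → (ℕ → A) → ℕ → A → (ℕ → A)
update f i a x = if x ≡ᵇ i then a else f x

argminFrom : (ℕ → ℕ) → ℕ → List ℕ → ℕ
argminFrom lev best []       = best
argminFrom lev best (i ∷ is) =
  argminFrom lev (if lev i <ᵇ lev best then i else best) is

argmin : ℕ → (ℕ → ℕ) → ℕ
argmin k lev = argminFrom lev 0 (upTo k)

-- level[i*] := max(level[i*], V_t)  (r is increasing, so max of values
-- is the value of the max of indices)
stepLevels : ℕ → (ℕ → ℕ) → ℕ → (ℕ → ℕ)
stepLevels k lev v = update lev (argmin k lev) (lev (argmin k lev) ⊔ v)

-- Finite distributions: lists of (probability, outcome)

Dist : Set → Set
Dist A = List (ℚ × A)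

countTrue : ℕ → (ℕ → Bool) → ℕ
countTrue k s = List.length (List.filterᵇ s (upTo k))

-- One step of Algorithm VT on the distribution of the sold-array.
vtStep : ℕ → ℕ → (ℕ → ℚ) → (ℕ → ℕ) → ℕ → Dist (ℕ → Bool) → Dist (ℕ → Bool)
vtStep m k r lev v = concatMap go
  where
  i = argmin k lev
  ℓ = lev i
  go : ℚ × (ℕ → Bool) → Dist (ℕ → Bool)
  go (p , s) =
    if s i then (p , s) ∷ []
    else (if null (priceDist m r ℓ) then (p , s) ∷ []
          else map (λ { (w , j) → (p * w ,
                        (if sells r v j then update s i true else s)) })
                   (priceDist m r ℓ))

-- γ_t(I): probability that sold[i*_t] = true in VT, conditioned on
-- VT having I units remaining after time t-1
gamma : ℕ → ℕ → ℕ → Dist (ℕ → Bool) → ℚ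
gamma k i I D =
  sumℚ (map proj₁ (List.filterᵇ (λ { (p , s) → ((k ∸ countTrue k s) ≡ᵇ I) ∧ s i }) D))
  ÷? sumℚ (map proj₁ (List.filterᵇ (λ { (p , s) → (k ∸ countTrue k s) ≡ᵇ I }) D))

-- One step of Algorithm VT' on the distribution of (inventory, revenue).
vtpStep : ℕ → ℕ → (ℕ → ℚ) → (ℕ → ℕ) → Dist (ℕ → Bool) → ℕ
        → Dist (ℕ × ℚ) → Dist (ℕ × ℚ)
vtpStep m k r lev D v = concatMap go
  where
  i = argmin k lev
  ℓ = lev i
  go : ℚ × (ℕ × ℚ) → Dist (ℕ × ℚ)
  go (p , (I , rev)) with I
  ... | zero = (p , (zero , rev)) ∷ []           -- no inventory: price ∞
  ... | suc I′ =
    if null (priceDist m r ℓ) then (p , (suc I′ , rev)) ∷ []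
    else (p * γ , (suc I′ , rev)) ∷
         map (λ { (w , j) → (p * (1ℚ - γ) * w ,
                   (if sells r v j then (I′ , rev + r j) else (suc I′ , rev))) })
             (priceDist m r ℓ)
    where γ = gamma k i (suc I′) D

record RunState : Set where
  constructor st
  field
    levels : ℕ → ℕ              -- levels of VT after the past valuations
    vtDist : Dist (ℕ → Bool)    -- distribution of VT's sold-array
    vtpDist : Dist (ℕ × ℚ)      -- distribution of VT''s (inventory, revenue)

runStep : ℕ → ℕ → (ℕ → ℚ) → RunState → ℕ → RunState
runStep m k r (st lev D D′) v =
  st (stepLevels k lev v) (vtStep m k r lev v D) (vtpStep m k r lev D v D′)

initState : ℕ → RunState
initState k = st (λ _ → 0) ((1ℚ , (λ _ → false)) ∷ []) ((1ℚ , (k , 0ℚ)) ∷ [])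

valIndices : ∀ {m T} → Vec (Fin (suc m)) T → List ℕ
valIndices V = map toℕ (Vec.toList V)

expectedALG : (m k : ℕ) → (ℕ → ℚ) → ∀ {T} → Vec (Fin (suc m)) T → ℚ
expectedALG m k r V =
  sumℚ (map (λ { (p , (_ , rev)) → p * rev })
            (RunState.vtpDist (foldl (runStep m k r) (initState k) (valIndices V))))

OPT : (m k : ℕ) → (ℕ → ℚ) → ∀ {T} → Vec (Fin (suc m)) T → ℚ
OPT m k r V = sumℚ (take k (reverse (sort (map r (valIndices V)))))

module Submission where

-- The proof couples VT′ with Algorithm VT, run on the same valuations, and follows both as finite
-- distributions (weighted lists).  VT keeps k slots with levels; on each customer the slot a of
-- minimal level r^{(ℓ)} is, if unsold, offered r^{(j)} (ℓ < j ≤ m) with probability q^{(j)} / Q ℓ,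
-- where Q ℓ = Σ_{ℓ<j≤m} q^{(j)}.  By induction over the customers (module Coupling) we maintain
--   (1) VT and VT′ have the same law of remaining inventory;
--   (2) E[revenue of VT′] = c* · Σ_i r^{(level_i)};
--   (3) slot i of VT is unsold with probability c* · Q(level_i).
-- The key step is the coupling identity: given inventory I, VT′ refuses to sell with probability
-- γ(I) = P[slot a sold | inventory I], so averaging over I reproduces VT's slot a exactly, and a sale
-- at level ℓ earns (r^{(ℓ⊔v)} - r^{(ℓ)}) / Q ℓ in expectation since q^{(j)} r^{(j)} = r^{(j)} - r^{(j-1)}.
-- Separately (module OptBound), a layer-cake argument shows OPT ≤ Σ_i r^{(level_i)}: for every
-- threshold r^{(j)}, at least min(k, #{t : V_t ≥ r^{(j)}}) slots end with level ≥ r^{(j)}.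

open import Defs
open import Data.Nat using (ℕ; suc; _≤_)
open import Data.Fin using (Fin)
open import Data.Vec using (Vec)
open import Data.Rational using (ℚ; _*_) renaming (_≤_ to _≤ℚ_)

open import Data.Bool using (Bool; true; false; if_then_else_; _∧_; not; T)
open import Data.Bool.Properties using (if-float)
open import Data.Nat as ℕ using (zero; _<_; _∸_; _≡ᵇ_; _⊔_; z≤n; s≤s)
import Data.Nat.Properties as ℕP
import Data.Fin.Properties as FinP
import Data.Vec as Vec
open import Data.List using (List; []; _∷_; map; _++_; concatMap; applyUpTo; upTo; filterᵇ; length; null; take; reverse; foldl)
open import Data.List.Properties using (map-applyUpTo; map-id)
open import Data.List.Relation.Unary.All as All using (All; []; _∷_)
import Data.List.Relation.Unary.All.Properties as AllP
open import Data.List.Membership.Propositional using (_∈_)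
open import Data.List.Membership.Propositional.Properties using (∈-upTo⁺; ∈-upTo⁻)
open import Data.List.Relation.Unary.Any using (here; there)
import Data.List.Relation.Binary.Permutation.Propositional as Perm
open import Data.List.Relation.Binary.Permutation.Propositional.Properties using (↭-reverse; All-resp-↭)
open import Data.Product using (_×_; _,_; proj₁; proj₂; ∃)
open import Data.Sum using (_⊎_; inj₁; inj₂)
open import Data.Rational as ℚ using (0ℚ; 1ℚ; _+_; _-_; -_) renaming (_<_ to _<ℚ_)
import Data.Rational.Properties as ℚP
open import Data.List.Sort ℚP.≤-decTotalOrder using (sort; sort-↭)
open import Data.Empty using (⊥-elim)
open import Relation.Nullary using (yes; no; does; Dec)
open import Relation.Nullary.Decidable using (dec-true; dec-false)
open import Relation.Binary.PropositionalEquality using (_≡_; _≢_; refl; sym; trans; cong; cong₂; subst; subst₂; module ≡-Reasoning)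
open import Data.Rational.Solver using (module +-*-Solver)
open +-*-Solver

∑< : ℕ → (ℕ → ℚ) → ℚ
∑< zero    g = 0ℚ
∑< (suc n) g = g 0 + ∑< n (λ i → g (suc i))

∑<-cong : ∀ n {g h : ℕ → ℚ} → (∀ i → i < n → g i ≡ h i) → ∑< n g ≡ ∑< n h
∑<-cong zero    eq = refl
∑<-cong (suc n) eq = cong₂ _+_ (eq 0 (s≤s z≤n)) (∑<-cong n (λ i i<n → eq (suc i) (s≤s i<n)))

∑<-+ : ∀ n (g h : ℕ → ℚ) → ∑< n (λ i → g i + h i) ≡ ∑< n g + ∑< n h
∑<-+ zero    g h = refl
∑<-+ (suc n) g h rewrite ∑<-+ n (λ i → g (suc i)) (λ i → h (suc i)) =
  solve 4 (λ a b u v → a :+ b :+ (u :+ v) := a :+ u :+ (b :+ v)) refl (g 0) (h 0) _ _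

∑<-* : ∀ n (c : ℚ) (g : ℕ → ℚ) → ∑< n (λ i → c * g i) ≡ c * ∑< n g
∑<-* zero    c g = sym (ℚP.*-zeroʳ c)
∑<-* (suc n) c g rewrite ∑<-* n c (λ i → g (suc i)) = sym (ℚP.*-distribˡ-+ c (g 0) _)

∑<-vanish : ∀ n (g : ℕ → ℚ) → (∀ i → i < n → g i ≡ 0ℚ) → ∑< n g ≡ 0ℚ
∑<-vanish zero    g eq = refl
∑<-vanish (suc n) g eq rewrite eq 0 (s≤s z≤n) | ∑<-vanish n (λ i → g (suc i)) (λ i i<n → eq (suc i) (s≤s i<n)) = refl

∑<-mono : ∀ n (g h : ℕ → ℚ) → (∀ i → i < n → g i ≤ℚ h i) → ∑< n g ≤ℚ ∑< n h
∑<-mono zero    g h le = ℚP.≤-refl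
∑<-mono (suc n) g h le = ℚP.+-mono-≤ (le 0 (s≤s z≤n)) (∑<-mono n _ _ (λ i i<n → le (suc i) (s≤s i<n)))

∑<-nonneg : ∀ n (g : ℕ → ℚ) → (∀ i → i < n → 0ℚ ≤ℚ g i) → 0ℚ ≤ℚ ∑< n g
∑<-nonneg n g nn = subst (_≤ℚ ∑< n g) (∑<-vanish n (λ _ → 0ℚ) (λ _ _ → refl)) (∑<-mono n _ g nn)

∑<-≥-term : ∀ n (g : ℕ → ℚ) → (∀ i → i < n → 0ℚ ≤ℚ g i) → ∀ i → i < n → g i ≤ℚ ∑< n g
∑<-≥-term (suc n) g nn zero    _ =
  subst (_≤ℚ ∑< (suc n) g) (ℚP.+-identityʳ (g 0))
        (ℚP.+-monoʳ-≤ (g 0) (∑<-nonneg n _ (λ i i<n → nn (suc i) (s≤s i<n))))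
∑<-≥-term (suc n) g nn (suc i) (s≤s i<n) =
  subst (_≤ℚ ∑< (suc n) g) (ℚP.+-identityˡ (g (suc i)))
        (ℚP.+-mono-≤ (nn 0 (s≤s z≤n)) (∑<-≥-term n _ (λ j j<n → nn (suc j) (s≤s j<n)) i i<n))

∑<-split : ∀ a b (g : ℕ → ℚ) → ∑< (a ℕ.+ b) g ≡ ∑< a g + ∑< b (λ i → g (a ℕ.+ i))
∑<-split zero    b g = sym (ℚP.+-identityˡ _)
∑<-split (suc a) b g rewrite ∑<-split a b (λ i → g (suc i)) = sym (ℚP.+-assoc (g 0) _ _)

∑<-truncate : ∀ {c n} (g h : ℕ → ℚ) → c ≤ n → (∀ i → i < c → g i ≡ h i) →
              (∀ i → c ≤ i → i < n → g i ≡ 0ℚ) → ∑< n g ≡ ∑< c h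
∑<-truncate {zero} {n} g h _ _ beyond = ∑<-vanish n g (λ i i<n → beyond i z≤n i<n)
∑<-truncate {suc c} {suc n} g h (s≤s c≤n) same beyond =
  cong₂ _+_ (same 0 (s≤s z≤n))
            (∑<-truncate (λ i → g (suc i)) (λ i → h (suc i)) c≤n
               (λ i i<c → same (suc i) (s≤s i<c)) (λ i c≤i i<n → beyond (suc i) (s≤s c≤i) (s≤s i<n)))

∑<-update : ∀ n i (g h : ℕ → ℚ) → i < n → (∀ j → j ≢ i → h j ≡ g j) → ∑< n h ≡ ∑< n g + (h i - g i)
∑<-update (suc n) zero g h _ others
  rewrite ∑<-cong n {λ j → h (suc j)} {λ j → g (suc j)} (λ j _ → others (suc j) (λ ())) =
  solve 3 (λ x y u → x :+ u := y :+ u :+ (x :- y)) refl (h 0) (g 0) _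
∑<-update (suc n) (suc i) g h (s≤s i<n) others
  rewrite others 0 (λ ())
        | ∑<-update n i (λ j → g (suc j)) (λ j → h (suc j)) i<n
            (λ j j≢i → others (suc j) (λ e → j≢i (ℕP.suc-injective e))) =
  sym (ℚP.+-assoc (g 0) _ _)

∑<-telescope : ∀ n a (g : ℕ → ℚ) → ∑< n (λ i → g (suc (a ℕ.+ i)) - g (a ℕ.+ i)) ≡ g (a ℕ.+ n) - g a
∑<-telescope zero    a g rewrite ℕP.+-identityʳ a = sym (ℚP.+-inverseʳ (g a))
∑<-telescope (suc n) a g = begin
    g (suc (a ℕ.+ 0)) - g (a ℕ.+ 0) + ∑< n (λ i → g (suc (a ℕ.+ suc i)) - g (a ℕ.+ suc i))
      ≡⟨ cong₂ (λ x y → g (suc x) - g x + y) (ℕP.+-identityʳ a)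
           (∑<-cong n (λ i _ → cong₂ (λ x y → g x - g y) (cong suc (ℕP.+-suc a i)) (ℕP.+-suc a i))) ⟩
    g (suc a) - g a + ∑< n (λ i → g (suc (suc a ℕ.+ i)) - g (suc a ℕ.+ i))
      ≡⟨ cong (g (suc a) - g a +_) (∑<-telescope n (suc a) g) ⟩
    g (suc a) - g a + (g (suc a ℕ.+ n) - g (suc a))
      ≡⟨ solve 3 (λ x y z → x :- y :+ (z :- x) := z :- y) refl (g (suc a)) (g a) (g (suc a ℕ.+ n)) ⟩
    g (suc a ℕ.+ n) - g a
      ≡⟨ cong (λ x → g x - g a) (sym (ℕP.+-suc a n)) ⟩
    g (a ℕ.+ suc n) - g a ∎
  where open ≡-Reasoning

∑<-swap : ∀ a b (F : ℕ → ℕ → ℚ) → ∑< a (λ t → ∑< b (λ i → F i t)) ≡ ∑< b (λ i → ∑< a (λ t → F i t))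
∑<-swap zero    b F = sym (∑<-vanish b (λ _ → 0ℚ) (λ _ _ → refl))
∑<-swap (suc a) b F rewrite ∑<-swap a b (λ i t → F i (suc t)) =
  sym (∑<-+ b (λ i → F i 0) (λ i → ∑< a (λ t → F i (suc t))))

sumℚ-applyUpTo : ∀ n (f : ℕ → ℚ) → sumℚ (applyUpTo f n) ≡ ∑< n f
sumℚ-applyUpTo zero    f = refl
sumℚ-applyUpTo (suc n) f rewrite sumℚ-applyUpTo n (λ i → f (suc i)) = refl

-- Interval sums  ∑⟨ a , b ] g = Σ_{a<j≤b} g j  (empty when b ≤ a); the price grid is summed this way.
∑⟨_,_] : ℕ → ℕ → (ℕ → ℚ) → ℚ
∑⟨ a , b ] g = ∑< (b ∸ a) (λ i → g (suc (a ℕ.+ i)))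

offset-≤ : ∀ a b i → i < b ∸ a → suc (a ℕ.+ i) ≤ b
offset-≤ a b i i<b∸a = subst (_≤ b) (trans (ℕP.+-comm (suc i) a) (ℕP.+-suc a i)) (ℕP.m≤o∸n⇒m+n≤o (suc i) a≤b i<b∸a)
  where
  a≤b : a ≤ b
  a≤b = ℕP.<⇒≤ (ℕP.m∸n≢0⇒n<m (λ e → ℕP.n≮0 (subst (i <_) e i<b∸a)))

∑⟨⟩-split : ∀ {a b c} (g : ℕ → ℚ) → a ≤ b → b ≤ c → ∑⟨ a , c ] g ≡ ∑⟨ a , b ] g + ∑⟨ b , c ] g
∑⟨⟩-split {a} {b} {c} g a≤b b≤c = begin
    ∑< (c ∸ a) G
      ≡⟨ cong (λ n → ∑< n G) termCount ⟩
    ∑< ((b ∸ a) ℕ.+ (c ∸ b)) G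
      ≡⟨ ∑<-split (b ∸ a) (c ∸ b) G ⟩
    ∑< (b ∸ a) G + ∑< (c ∸ b) (λ i → G ((b ∸ a) ℕ.+ i))
      ≡⟨ cong (∑< (b ∸ a) G +_) (∑<-cong (c ∸ b) (λ i _ → cong (λ x → g (suc x)) (shift i))) ⟩
    ∑⟨ a , b ] g + ∑⟨ b , c ] g ∎
  where
  open ≡-Reasoning
  G : ℕ → ℚ
  G i = g (suc (a ℕ.+ i))
  termCount : c ∸ a ≡ (b ∸ a) ℕ.+ (c ∸ b)
  termCount = trans (cong (_∸ a) (sym (ℕP.m+[n∸m]≡n b≤c))) (ℕP.+-∸-comm (c ∸ b) a≤b)
  shift : ∀ i → a ℕ.+ ((b ∸ a) ℕ.+ i) ≡ b ℕ.+ i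
  shift i = trans (sym (ℕP.+-assoc a (b ∸ a) i)) (cong (ℕ._+ i) (ℕP.m+[n∸m]≡n a≤b))

∑⟨⟩-restrict : ∀ {a b n} (g h : ℕ → ℚ) → b ≤ n → (∀ j → a < j → j ≤ b → g j ≡ h j) →
               (∀ j → b < j → j ≤ n → g j ≡ 0ℚ) → ∑⟨ a , n ] g ≡ ∑⟨ a , b ] h
∑⟨⟩-restrict {a} {b} {n} g h b≤n same beyond =
  ∑<-truncate _ _ (ℕP.∸-monoˡ-≤ a b≤n)
    (λ i i<b∸a → same _ (s≤s (ℕP.m≤m+n a i)) (offset-≤ a b i i<b∸a))
    (λ i b∸a≤i i<n∸a → beyond _ (s≤s (ℕP.≤-trans (ℕP.m≤n+m∸n b a) (ℕP.+-monoʳ-≤ a b∸a≤i))) (offset-≤ a n i i<n∸a))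

∑⟨⟩-telescope : ∀ {a b} (g : ℕ → ℚ) → a ≤ b → ∑⟨ a , b ] (λ j → g j - g (j ∸ 1)) ≡ g b - g a
∑⟨⟩-telescope {a} {b} g a≤b =
  trans (∑<-telescope (b ∸ a) a g) (cong (λ x → g x - g a) (ℕP.m+[n∸m]≡n a≤b))

E : {A : Set} → Dist A → (A → ℚ) → ℚ
E []            f = 0ℚ
E ((p , a) ∷ D) f = p * f a + E D f

ind : Bool → ℚ
ind true  = 1ℚ
ind false = 0ℚ

ind-nonneg : ∀ b → 0ℚ ≤ℚ ind b
ind-nonneg true  = ℚP.<⇒≤ (ℚP.positive⁻¹ 1ℚ)
ind-nonneg false = ℚP.≤-refl

ind-∧ : ∀ a b → ind (a ∧ b) ≡ ind a * ind b
ind-∧ true  true  = refl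
ind-∧ true  false = refl
ind-∧ false b     = sym (ℚP.*-zeroˡ (ind b))

NonNeg : {A : Set} → Dist A → Set
NonNeg {A} D = ∀ (f : A → ℚ) → (∀ a → 0ℚ ≤ℚ f a) → 0ℚ ≤ℚ E D f

module _ {A : Set} where

  E-++ : (D D′ : Dist A) (f : A → ℚ) → E (D ++ D′) f ≡ E D f + E D′ f
  E-++ []            D′ f = sym (ℚP.+-identityˡ _)
  E-++ ((p , a) ∷ D) D′ f rewrite E-++ D D′ f = sym (ℚP.+-assoc (p * f a) _ _)

  E-cong : (D : Dist A) {f g : A → ℚ} → (∀ a → f a ≡ g a) → E D f ≡ E D g
  E-cong []            eq = refl
  E-cong ((p , a) ∷ D) eq rewrite eq a | E-cong D eq = refl

  E-congAll : (P : A → Set) (D : Dist A) {f g : A → ℚ} → All (λ e → P (proj₂ e)) D →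
              (∀ a → P a → f a ≡ g a) → E D f ≡ E D g
  E-congAll P []            _         eq = refl
  E-congAll P ((p , a) ∷ D) (pa ∷ pD) eq rewrite eq a pa | E-congAll P D pD eq = refl

  E-+ : (D : Dist A) (f g : A → ℚ) → E D (λ a → f a + g a) ≡ E D f + E D g
  E-+ []            f g = refl
  E-+ ((p , a) ∷ D) f g rewrite E-+ D f g =
    solve 5 (λ p x y u v → p :* (x :+ y) :+ (u :+ v) := p :* x :+ u :+ (p :* y :+ v)) refl p (f a) (g a) (E D f) (E D g)

  E-* : (D : Dist A) (c : ℚ) (f : A → ℚ) → E D (λ a → c * f a) ≡ c * E D f
  E-* []            c f = sym (ℚP.*-zeroʳ c)
  E-* ((p , a) ∷ D) c f rewrite E-* D c f =
    solve 4 (λ p c x u → p :* (c :* x) :+ c :* u := c :* (p :* x :+ u)) refl p c (f a) (E D f)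

  E-0 : (D : Dist A) → E D (λ _ → 0ℚ) ≡ 0ℚ
  E-0 []            = refl
  E-0 ((p , a) ∷ D) rewrite E-0 D | ℚP.*-zeroʳ p = refl

  E-∑< : (D : Dist A) (n : ℕ) (F : ℕ → A → ℚ) → E D (λ a → ∑< n (λ I → F I a)) ≡ ∑< n (λ I → E D (F I))
  E-∑< D zero    F = E-0 D
  E-∑< D (suc n) F = trans (E-+ D (F 0) _) (cong (E D (F 0) +_) (E-∑< D n (λ I → F (suc I))))

  -- the defining sums of expectedALG and gamma are expectations
  sumℚ-map-E : (D : Dist A) (h : ℚ × A → ℚ) (f : A → ℚ) → (∀ p a → h (p , a) ≡ p * f a) →
               sumℚ (map h D) ≡ E D f
  sumℚ-map-E []            h f eq = refl
  sumℚ-map-E ((p , a) ∷ D) h f eq rewrite eq p a | sumℚ-map-E D h f eq = refl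

  mass-filter-E : (D : Dist A) (P : ℚ × A → Bool) (b : A → Bool) → (∀ p a → P (p , a) ≡ b a) →
                  sumℚ (map proj₁ (filterᵇ P D)) ≡ E D (λ a → ind (b a))
  mass-filter-E []            P b eq = refl
  mass-filter-E ((p , a) ∷ D) P b eq rewrite eq p a with b a
  ... | true  = cong₂ _+_ (sym (ℚP.*-identityʳ p)) (mass-filter-E D P b eq)
  ... | false = trans (mass-filter-E D P b eq)
                      (sym (trans (cong (_+ E D (λ a → ind (b a))) (ℚP.*-zeroʳ p)) (ℚP.+-identityˡ _)))

module _ {A B : Set} where

  E-map : (D : Dist A) (F : ℚ × A → ℚ × B) (c : ℚ) (h : A → B) (f : B → ℚ) →
          (∀ w a → F (w , a) ≡ (c * w , h a)) → E (map F D) f ≡ c * E D (λ a → f (h a))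
  E-map []            F c h f eq = sym (ℚP.*-zeroʳ c)
  E-map ((w , a) ∷ D) F c h f eq rewrite eq w a | E-map D F c h f eq =
    solve 4 (λ c w x u → c :* w :* x :+ c :* u := c :* (w :* x :+ u)) refl c w (f (h a)) (E D (λ a → f (h a)))

  -- one step of a randomised process: each atom is replaced by a sub-distribution
  E-concatMap : (D : Dist A) (go : ℚ × A → Dist B) (f : B → ℚ) (g : A → ℚ) →
                (∀ p a → E (go (p , a)) f ≡ p * g a) → E (concatMap go D) f ≡ E D g
  E-concatMap []            go f g eq = refl
  E-concatMap ((p , a) ∷ D) go f g eq =
    trans (E-++ (go (p , a)) _ f) (cong₂ _+_ (eq p a) (E-concatMap D go f g eq))

≡ᵇ-refl : ∀ i → (i ≡ᵇ i) ≡ true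
≡ᵇ-refl zero    = refl
≡ᵇ-refl (suc i) = ≡ᵇ-refl i

≡ᵇ-false : ∀ x i → x ≢ i → (x ≡ᵇ i) ≡ false
≡ᵇ-false zero    zero    ne = ⊥-elim (ne refl)
≡ᵇ-false zero    (suc i) ne = refl
≡ᵇ-false (suc x) zero    ne = refl
≡ᵇ-false (suc x) (suc i) ne = ≡ᵇ-false x i (λ e → ne (cong suc e))

≡ᵇ-true : ∀ x i → (x ≡ᵇ i) ≡ true → x ≡ i
≡ᵇ-true x i e = ℕP.≡ᵇ⇒≡ x i (subst T (sym e) _)

ind-subst : ∀ (g : ℕ → ℚ) x I → g x * ind (x ≡ᵇ I) ≡ g I * ind (x ≡ᵇ I)
ind-subst g x I with x ≡ᵇ I in eq
... | true  = cong (λ z → g z * 1ℚ) (≡ᵇ-true x I eq)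
... | false = trans (ℚP.*-zeroʳ (g x)) (sym (ℚP.*-zeroʳ (g I)))

∑<-pick : ∀ n (c : ℚ) x → x < n → ∑< n (λ I → c * ind (x ≡ᵇ I)) ≡ c
∑<-pick (suc n) c zero _
  rewrite ∑<-vanish n (λ I → c * ind (0 ≡ᵇ suc I)) (λ _ _ → ℚP.*-zeroʳ c) =
  trans (ℚP.+-identityʳ _) (ℚP.*-identityʳ c)
∑<-pick (suc n) c (suc x) (s≤s x<n) rewrite ∑<-pick n c x x<n =
  trans (cong (_+ c) (ℚP.*-zeroʳ c)) (ℚP.+-identityˡ c)

module Partition {A : Set} (D : Dist A) (π : A → ℕ) (K : ℕ) (bounded : All (λ e → π (proj₂ e) ≤ K) D) where

  E-partition : ∀ (F : A → ℚ) → E D F ≡ ∑< (suc K) (λ I → E D (λ a → F a * ind (π a ≡ᵇ I)))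
  E-partition F =
    trans (E-congAll (λ a → π a ≤ K) D bounded (λ a π≤K → sym (∑<-pick (suc K) (F a) (π a) (s≤s π≤K))))
          (E-∑< D (suc K) (λ I a → F a * ind (π a ≡ᵇ I)))

  E-via-law : ∀ (g : ℕ → ℚ) → E D (λ a → g (π a)) ≡ ∑< (suc K) (λ I → g I * E D (λ a → ind (π a ≡ᵇ I)))
  E-via-law g = trans (E-partition (λ a → g (π a)))
    (∑<-cong (suc K) (λ I _ → trans (E-cong D (λ a → ind-subst g (π a) I)) (E-* D (g I) _)))

update-same : {A : Set} (f : ℕ → A) (i : ℕ) (a : A) → update f i a i ≡ a
update-same f i a rewrite ≡ᵇ-refl i = refl

update-other : {A : Set} (f : ℕ → A) (i : ℕ) (a : A) (j : ℕ) → j ≢ i → update f i a j ≡ f j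
update-other f i a j ne rewrite ≡ᵇ-false j i ne = refl

bit : Bool → ℕ
bit true  = 1
bit false = 0

#< : ℕ → (ℕ → ℕ) → ℕ
#< zero    g = 0
#< (suc n) g = g 0 ℕ.+ #< n (λ i → g (suc i))

#<-cong : ∀ n {g h : ℕ → ℕ} → (∀ i → i < n → g i ≡ h i) → #< n g ≡ #< n h
#<-cong zero    eq = refl
#<-cong (suc n) eq = cong₂ ℕ._+_ (eq 0 (s≤s z≤n)) (#<-cong n (λ i i<n → eq (suc i) (s≤s i<n)))

#<-bits : ∀ n (s : ℕ → Bool) → #< n (λ i → bit (s i)) ≤ n
#<-bits zero    s = z≤n
#<-bits (suc n) s = ℕP.+-mono-≤ (bit≤1 (s 0)) (#<-bits n (λ i → s (suc i)))
  where
  bit≤1 : ∀ b → bit b ≤ 1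
  bit≤1 true  = s≤s z≤n
  bit≤1 false = z≤n

#<-flip : ∀ n i (g h : ℕ → ℕ) → i < n → (∀ j → j ≢ i → h j ≡ g j) → g i ≡ 0 → h i ≡ 1 → #< n h ≡ suc (#< n g)
#<-flip (suc n) zero g h _ others g0 h1 rewrite g0 | h1 =
  cong suc (#<-cong n (λ j _ → others (suc j) (λ ())))
#<-flip (suc n) (suc i) g h (s≤s i<n) others g0 h1 rewrite others 0 (λ ()) =
  trans (cong (g 0 ℕ.+_) (#<-flip n i (λ j → g (suc j)) (λ j → h (suc j)) i<n
                            (λ j j≢i → others (suc j) (λ e → j≢i (ℕP.suc-injective e))) g0 h1))
        (ℕP.+-suc (g 0) _)

countTrue-#< : ∀ k s → countTrue k s ≡ #< k (λ i → bit (s i))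
countTrue-#< k s = go k (λ x → x)
  where
  go : ∀ n (h : ℕ → ℕ) → length (filterᵇ s (applyUpTo h n)) ≡ #< n (λ i → bit (s (h i)))
  go zero    h = refl
  go (suc n) h with s (h 0)
  ... | true  = cong suc (go n (λ i → h (suc i)))
  ... | false = go n (λ i → h (suc i))

module Slots (k : ℕ) where

  inventory : (ℕ → Bool) → ℕ
  inventory s = k ∸ countTrue k s

  inventory-≤ : ∀ s → inventory s ≤ k
  inventory-≤ s = ℕP.m∸n≤m k (countTrue k s)

  count-≤ : ∀ s → countTrue k s ≤ k
  count-≤ s rewrite countTrue-#< k s = #<-bits k s

  count-none : countTrue k (λ _ → false) ≡ 0
  count-none rewrite countTrue-#< k (λ _ → false) = lemma k
    where
    lemma : ∀ n → #< n (λ _ → 0) ≡ 0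
    lemma zero    = refl
    lemma (suc n) = lemma n

  count-sell : ∀ s i → i < k → s i ≡ false → countTrue k (update s i true) ≡ suc (countTrue k s)
  count-sell s i i<k si rewrite countTrue-#< k s | countTrue-#< k (update s i true) =
    #<-flip k i _ _ i<k (λ j ne → cong bit (update-other s i true j ne))
      (cong bit si) (cong bit (update-same s i true))

  inventory-sell : ∀ s i → i < k → s i ≡ false → inventory (update s i true) ≡ ℕ.pred (inventory s)
  inventory-sell s i i<k si rewrite count-sell s i i<k si = sym (ℕP.pred[m∸n]≡m∸[1+n] k (countTrue k s))

  inventory-unsold : ∀ s i → i < k → s i ≡ false → inventory s ≢ 0
  inventory-unsold s i i<k si e = ℕP.<-irrefl
    (trans (cong (ℕ._+ countTrue k s) (sym e)) (ℕP.m∸n+n≡m (count-≤ s)))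
    (subst (_≤ k) (count-sell s i i<k si) (count-≤ (update s i true)))

argminFrom-all : (lev : ℕ → ℕ) (P : ℕ → Set) (best : ℕ) (xs : List ℕ) → P best → All P xs → P (argminFrom lev best xs)
argminFrom-all lev P best []       pb _          = pb
argminFrom-all lev P best (i ∷ is) pb (pi ∷ pis) with lev i ℕ.<ᵇ lev best
... | true  = argminFrom-all lev P i is pi pis
... | false = argminFrom-all lev P best is pb pis

argminFrom-min : (lev : ℕ → ℕ) (best : ℕ) (xs : List ℕ) →
                 lev (argminFrom lev best xs) ≤ lev best × (∀ x → x ∈ xs → lev (argminFrom lev best xs) ≤ lev x)
argminFrom-min lev best []       = ℕP.≤-refl , (λ x ())
argminFrom-min lev best (i ∷ is) with lev i ℕ.<ᵇ lev best in eq
... | true  = ℕP.≤-trans (proj₁ ih) (ℕP.<⇒≤ (ℕP.<ᵇ⇒< (lev i) (lev best) (subst T (sym eq) _)))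
            , λ { x (here refl) → proj₁ ih ; x (there p) → proj₂ ih x p }
  where ih = argminFrom-min lev i is
... | false = proj₁ ih
            , λ { x (here refl) → ℕP.≤-trans (proj₁ ih) (ℕP.≮⇒≥ (λ lt → subst T eq (ℕP.<⇒<ᵇ lt)))
                ; x (there p) → proj₂ ih x p }
  where ih = argminFrom-min lev best is

argmin-< : ∀ k lev → 0 < k → argmin k lev < k
argmin-< k lev 0<k = argminFrom-all lev (_< k) 0 (upTo k) 0<k (All.tabulate ∈-upTo⁻)

argmin-min : ∀ k lev i → i < k → lev (argmin k lev) ≤ lev i
argmin-min k lev i i<k = proj₂ (argminFrom-min lev 0 (upTo k)) i (∈-upTo⁺ i<k)

÷?-as-* : ∀ x d → x ÷? d ≡ x * (1ℚ ÷? d)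
÷?-as-* x d with d ℚ.≟ 0ℚ
... | yes _ = sym (ℚP.*-zeroʳ x)
... | no _  = cong (x *_) (sym (ℚP.*-identityˡ _))

÷?-inverseʳ : ∀ d → d ≢ 0ℚ → d * (1ℚ ÷? d) ≡ 1ℚ
÷?-inverseʳ d d≢0 with d ℚ.≟ 0ℚ
... | yes d≡0 = ⊥-elim (d≢0 d≡0)
... | no d≢0′ = trans (cong (d *_) (ℚP.*-identityˡ _)) (ℚP.*-inverseʳ d {{ℚ.≢-nonZero d≢0′}})

1÷?-nonneg : ∀ d → 0ℚ ≤ℚ d → 0ℚ ≤ℚ 1ℚ ÷? d
1÷?-nonneg d 0≤d with d ℚ.≟ 0ℚ
... | yes _   = ℚP.≤-refl
... | no d≢0 = ℚP.≤-trans (ℚP.<⇒≤ 1/d>0) (ℚP.≤-reflexive (sym (ℚP.*-identityˡ _)))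
  where
  d>0 : ℚ.Positive d
  d>0 = ℚP.nonNeg∧nonZero⇒pos d {{ℚ.nonNegative 0≤d}} {{ℚ.≢-nonZero d≢0}}
  1/d>0 : 0ℚ <ℚ (ℚ.1/ d) {{ℚ.≢-nonZero d≢0}}
  1/d>0 = ℚP.positive⁻¹ _ {{ℚP.1/pos⇒pos d {{d>0}}}}

diff-pos : ∀ {a b} → a <ℚ b → 0ℚ <ℚ b - a
diff-pos {a} {b} a<b = subst (_<ℚ b - a) (ℚP.+-inverseʳ a) (ℚP.+-monoˡ-< (- a) a<b)

diff-nonneg : ∀ {a b} → a ≤ℚ b → 0ℚ ≤ℚ b - a
diff-nonneg {a} {b} a≤b = subst (_≤ℚ b - a) (ℚP.+-inverseʳ a) (ℚP.+-monoˡ-≤ (- a) a≤b)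

*-nonneg : ∀ {a b} → 0ℚ ≤ℚ a → 0ℚ ≤ℚ b → 0ℚ ≤ℚ a * b
*-nonneg {a} {b} 0≤a 0≤b = subst (_≤ℚ a * b) (ℚP.*-zeroʳ a) (ℚP.*-monoˡ-≤-nonNeg a {{ℚ.nonNegative 0≤a}} 0≤b)

-- the empty list has mass 0, so a probability distribution is never empty
0ℚ≢1ℚ : 0ℚ ≢ 1ℚ
0ℚ≢1ℚ e = ℚP.<-irrefl e (ℚP.positive⁻¹ 1ℚ)

nonneg-sum-zero : ∀ {a b} → 0ℚ ≤ℚ a → 0ℚ ≤ℚ b → a + b ≡ 0ℚ → a ≡ 0ℚ
nonneg-sum-zero {a} {b} 0≤a 0≤b a+b≡0 =
  ℚP.≤-antisym (subst (a ≤ℚ_) a+b≡0 (subst (_≤ℚ a + b) (ℚP.+-identityʳ a) (ℚP.+-monoʳ-≤ a 0≤b))) 0≤a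

if-nonneg : ∀ b {x y : ℚ} → 0ℚ ≤ℚ x → 0ℚ ≤ℚ y → 0ℚ ≤ℚ (if b then x else y)
if-nonneg true  x≥0 _ = x≥0
if-nonneg false _ y≥0 = y≥0

above-⊔ : ∀ ℓ v j → ℓ < j → j ≤ ℓ ⊔ v → j ≤ v
above-⊔ ℓ v j ℓ<j j≤ℓ⊔v with ℕP.≤-total ℓ v
... | inj₁ ℓ≤v = subst (j ≤_) (ℕP.m≤n⇒m⊔n≡n ℓ≤v) j≤ℓ⊔v
... | inj₂ v≤ℓ = ⊥-elim (ℕP.<⇒≱ ℓ<j (subst (j ≤_) (ℕP.m≥n⇒m⊔n≡m v≤ℓ) j≤ℓ⊔v))

sum-indicesAbove : ∀ m ℓ (h : ℕ → ℚ) → sumℚ (map h (indicesAbove m ℓ)) ≡ ∑⟨ ℓ , m ] h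
sum-indicesAbove m ℓ h = begin
    sumℚ (map h (map (λ i → suc (ℓ ℕ.+ i)) (upTo (m ∸ ℓ))))
      ≡⟨ cong (λ z → sumℚ (map h z)) (map-applyUpTo (λ x → x) (λ i → suc (ℓ ℕ.+ i)) (m ∸ ℓ)) ⟩
    sumℚ (map h (applyUpTo (λ i → suc (ℓ ℕ.+ i)) (m ∸ ℓ)))
      ≡⟨ cong sumℚ (map-applyUpTo (λ i → suc (ℓ ℕ.+ i)) h (m ∸ ℓ)) ⟩
    sumℚ (applyUpTo (λ i → h (suc (ℓ ℕ.+ i))) (m ∸ ℓ))
      ≡⟨ sumℚ-applyUpTo (m ∸ ℓ) _ ⟩
    ∑⟨ ℓ , m ] h ∎
  where open ≡-Reasoning

module PriceGrid (m : ℕ) (r : ℕ → ℚ) (valid : ValidPrices m r) where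

  r-strict : ∀ a b → a < b → b ≤ m → r a <ℚ r b
  r-strict a (suc b) a<1+b 1+b≤m with ℕP.m≤n⇒m<n∨m≡n (ℕP.m<1+n⇒m≤n a<1+b)
  ... | inj₁ a<b  = ℚP.<-trans (r-strict a b a<b (ℕP.<⇒≤ 1+b≤m)) (proj₂ valid b 1+b≤m)
  ... | inj₂ refl = proj₂ valid a 1+b≤m

  r-mono : ∀ a b → a ≤ b → b ≤ m → r a ≤ℚ r b
  r-mono a b a≤b b≤m with ℕP.m≤n⇒m<n∨m≡n a≤b
  ... | inj₁ a<b  = ℚP.<⇒≤ (r-strict a b a<b b≤m)
  ... | inj₂ refl = ℚP.≤-refl

  r-pos : ∀ a → 0 < a → a ≤ m → 0ℚ <ℚ r a
  r-pos a 0<a a≤m = subst (_<ℚ r a) (proj₁ valid) (r-strict 0 a 0<a a≤m)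

  buys : ∀ v j → j ≤ v → v ≤ m → sells r v j ≡ true
  buys v j j≤v v≤m = dec-true (r j ℚ.≤? r v) (r-mono j v j≤v v≤m)

  declines : ∀ v j → v < j → j ≤ m → sells r v j ≡ false
  declines v j v<j j≤m = dec-false (r j ℚ.≤? r v) (λ rj≤rv → ℚP.<-irrefl refl (ℚP.<-≤-trans (r-strict v j v<j j≤m) rj≤rv))

  -- q^{(j)} r^{(j)} = r^{(j)} - r^{(j-1)}: a sale at r^{(j)} with probability ∝ q^{(j)} earns a price increment
  q·r : ∀ j → 0 < j → j ≤ m → qj r j * r j ≡ r j - r (j ∸ 1)
  q·r j 0<j j≤m = begin
      (1ℚ - r (j ∸ 1) ÷? r j) * r j
        ≡⟨ cong (λ z → (1ℚ - z) * r j) (÷?-as-* (r (j ∸ 1)) (r j)) ⟩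
      (1ℚ - r (j ∸ 1) * (1ℚ ÷? r j)) * r j
        ≡⟨ solve 3 (λ a b x → (con 1ℚ :- a :* x) :* b := b :- a :* (b :* x)) refl (r (j ∸ 1)) (r j) (1ℚ ÷? r j) ⟩
      r j - r (j ∸ 1) * (r j * (1ℚ ÷? r j))
        ≡⟨ cong (λ z → r j - r (j ∸ 1) * z) (÷?-inverseʳ (r j) (λ e → ℚP.<-irrefl (sym e) (r-pos j 0<j j≤m))) ⟩
      r j - r (j ∸ 1) * 1ℚ
        ≡⟨ cong (λ z → r j - z) (ℚP.*-identityʳ _) ⟩
      r j - r (j ∸ 1) ∎
    where open ≡-Reasoning

  q-pos : ∀ j → 0 < j → j ≤ m → 0ℚ <ℚ qj r j
  q-pos (suc j) 0<j j≤m = ℚP.*-cancelʳ-<-nonNeg (r (suc j)) {{ℚ.nonNegative (ℚP.<⇒≤ (r-pos (suc j) 0<j j≤m))}}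
    (subst₂ _<ℚ_ (sym (ℚP.*-zeroˡ (r (suc j)))) (sym (q·r (suc j) 0<j j≤m))
            (diff-pos (r-strict j (suc j) (ℕP.n<1+n j) j≤m)))

  -- Q ℓ = Σ_{ℓ<j≤m} q^{(j)}, the normaliser of VT's price distribution at level r^{(ℓ)}
  Q : ℕ → ℚ
  Q ℓ = sumℚ (map (qj r) (indicesAbove m ℓ))

  Q-nonneg : ∀ ℓ → 0ℚ ≤ℚ Q ℓ
  Q-nonneg ℓ = subst (0ℚ ≤ℚ_) (sym (sum-indicesAbove m ℓ (qj r)))
    (∑<-nonneg (m ∸ ℓ) _ (λ i i<m∸ℓ → ℚP.<⇒≤ (q-pos _ (s≤s z≤n) (offset-≤ ℓ m i i<m∸ℓ))))

  Q-pos : ∀ ℓ → ℓ < m → 0ℚ <ℚ Q ℓ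
  Q-pos ℓ ℓ<m = subst (0ℚ <ℚ_) (sym (sum-indicesAbove m ℓ (qj r)))
    (ℚP.<-≤-trans (q-pos _ (s≤s z≤n) (offset-≤ ℓ m 0 0<m∸ℓ))
       (∑<-≥-term (m ∸ ℓ) _ (λ i i<m∸ℓ → ℚP.<⇒≤ (q-pos _ (s≤s z≤n) (offset-≤ ℓ m i i<m∸ℓ))) 0 0<m∸ℓ))
    where
    0<m∸ℓ : 0 < m ∸ ℓ
    0<m∸ℓ = ℕP.m<n⇒0<n∸m ℓ<m

  Q-inverse : ∀ ℓ → ℓ < m → (1ℚ ÷? Q ℓ) * Q ℓ ≡ 1ℚ
  Q-inverse ℓ ℓ<m = trans (ℚP.*-comm _ (Q ℓ)) (÷?-inverseʳ (Q ℓ) (λ e → ℚP.<-irrefl (sym e) (Q-pos ℓ ℓ<m)))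

  Q-split : ∀ ℓ b → ℓ ≤ b → b ≤ m → Q ℓ ≡ ∑⟨ ℓ , b ] (qj r) + Q b
  Q-split ℓ b ℓ≤b b≤m = begin
      Q ℓ                               ≡⟨ sum-indicesAbove m ℓ (qj r) ⟩
      ∑⟨ ℓ , m ] (qj r)                 ≡⟨ ∑⟨⟩-split (qj r) ℓ≤b b≤m ⟩
      ∑⟨ ℓ , b ] (qj r) + ∑⟨ b , m ] (qj r) ≡⟨ cong (∑⟨ ℓ , b ] (qj r) +_) (sym (sum-indicesAbove m b (qj r))) ⟩
      ∑⟨ ℓ , b ] (qj r) + Q b ∎
    where open ≡-Reasoning

  priceDist-E : ∀ ℓ (g : ℕ → ℚ) → E (priceDist m r ℓ) g ≡ (1ℚ ÷? Q ℓ) * ∑⟨ ℓ , m ] (λ j → qj r j * g j)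
  priceDist-E ℓ g = begin
      E (priceDist m r ℓ) g
        ≡⟨ weights (indicesAbove m ℓ) ⟩
      sumℚ (map (λ j → (qj r j ÷? Q ℓ) * g j) (indicesAbove m ℓ))
        ≡⟨ sum-indicesAbove m ℓ _ ⟩
      ∑⟨ ℓ , m ] (λ j → (qj r j ÷? Q ℓ) * g j)
        ≡⟨ ∑<-cong (m ∸ ℓ) (λ i _ → reassoc (suc (ℓ ℕ.+ i))) ⟩
      ∑⟨ ℓ , m ] (λ j → (1ℚ ÷? Q ℓ) * (qj r j * g j))
        ≡⟨ ∑<-* (m ∸ ℓ) (1ℚ ÷? Q ℓ) _ ⟩
      (1ℚ ÷? Q ℓ) * ∑⟨ ℓ , m ] (λ j → qj r j * g j) ∎
    where
    open ≡-Reasoning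
    weights : ∀ js → E (map (λ j → (qj r j ÷? Q ℓ , j)) js) g ≡ sumℚ (map (λ j → (qj r j ÷? Q ℓ) * g j) js)
    weights []       = refl
    weights (j ∷ js) = cong ((qj r j ÷? Q ℓ) * g j +_) (weights js)
    reassoc : ∀ j → (qj r j ÷? Q ℓ) * g j ≡ (1ℚ ÷? Q ℓ) * (qj r j * g j)
    reassoc j = trans (cong (_* g j) (÷?-as-* (qj r j) (Q ℓ)))
                      (solve 3 (λ a x b → a :* x :* b := x :* (a :* b)) refl (qj r j) (1ℚ ÷? Q ℓ) (g j))

  priceDist-E·Q : ∀ ℓ → ℓ < m → (g : ℕ → ℚ) → E (priceDist m r ℓ) g * Q ℓ ≡ ∑⟨ ℓ , m ] (λ j → qj r j * g j)
  priceDist-E·Q ℓ ℓ<m g = begin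
      E (priceDist m r ℓ) g * Q ℓ                       ≡⟨ cong (_* Q ℓ) (priceDist-E ℓ g) ⟩
      (1ℚ ÷? Q ℓ) * S * Q ℓ                            ≡⟨ solve 3 (λ x s q → x :* s :* q := x :* q :* s) refl (1ℚ ÷? Q ℓ) S (Q ℓ) ⟩
      (1ℚ ÷? Q ℓ) * Q ℓ * S                            ≡⟨ cong (_* S) (Q-inverse ℓ ℓ<m) ⟩
      1ℚ * S                                           ≡⟨ ℚP.*-identityˡ S ⟩
      S ∎
    where
    open ≡-Reasoning
    S = ∑⟨ ℓ , m ] (λ j → qj r j * g j)

  priceDist-mass : ∀ ℓ → ℓ < m → E (priceDist m r ℓ) (λ _ → 1ℚ) ≡ 1ℚ
  priceDist-mass ℓ ℓ<m = begin
      E (priceDist m r ℓ) (λ _ → 1ℚ)               ≡⟨ priceDist-E ℓ _ ⟩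
      (1ℚ ÷? Q ℓ) * ∑⟨ ℓ , m ] (λ j → qj r j * 1ℚ) ≡⟨ cong ((1ℚ ÷? Q ℓ) *_) (∑<-cong (m ∸ ℓ) (λ i _ → ℚP.*-identityʳ _)) ⟩
      (1ℚ ÷? Q ℓ) * ∑⟨ ℓ , m ] (qj r)              ≡⟨ cong ((1ℚ ÷? Q ℓ) *_) (sym (sum-indicesAbove m ℓ (qj r))) ⟩
      (1ℚ ÷? Q ℓ) * Q ℓ                            ≡⟨ Q-inverse ℓ ℓ<m ⟩
      1ℚ ∎
    where open ≡-Reasoning

  priceDist-top : priceDist m r m ≡ []
  priceDist-top rewrite ℕP.n∸n≡0 m = refl

  priceDist-nonneg : ∀ ℓ → NonNeg (priceDist m r ℓ)
  priceDist-nonneg ℓ g g≥0 = subst (0ℚ ≤ℚ_) (sym (priceDist-E ℓ g))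
    (*-nonneg (1÷?-nonneg (Q ℓ) (Q-nonneg ℓ))
       (∑<-nonneg (m ∸ ℓ) _ (λ i i<m∸ℓ → *-nonneg (ℚP.<⇒≤ (q-pos _ (s≤s z≤n) (offset-≤ ℓ m i i<m∸ℓ))) (g≥0 _))))

  -- Facing valuation r^{(v)} at level ℓ < m, VT sells at r^{(j)} for ℓ < j ≤ ℓ ⊔ v.  Hence
  -- P[no sale] · Q ℓ = Q (ℓ ⊔ v)  and  E[revenue] · Q ℓ = r^{(ℓ ⊔ v)} - r^{(ℓ)}.
  module Sale (ℓ v : ℕ) (ℓ<m : ℓ < m) (v≤m : v ≤ m) where

    saleProb : ℚ
    saleProb = E (priceDist m r ℓ) (λ j → ind (sells r v j))

    saleRevenue : ℚ
    saleRevenue = E (priceDist m r ℓ) (λ j → ind (sells r v j) * r j)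

    private
      ℓ⊔v≤m : ℓ ⊔ v ≤ m
      ℓ⊔v≤m = ℕP.⊔-lub (ℕP.<⇒≤ ℓ<m) v≤m

      restrict : (x y : ℕ → ℚ) → (∀ j → ℓ < j → j ≤ ℓ ⊔ v → qj r j * x j ≡ y j) →
                 ∑⟨ ℓ , m ] (λ j → qj r j * (ind (sells r v j) * x j)) ≡ ∑⟨ ℓ , ℓ ⊔ v ] y
      restrict x y xy = ∑⟨⟩-restrict _ y ℓ⊔v≤m
        (λ j ℓ<j j≤ℓ⊔v → trans (cong (λ b → qj r j * (ind b * x j)) (buys v j (above-⊔ ℓ v j ℓ<j j≤ℓ⊔v) v≤m))
                               (trans (cong (qj r j *_) (ℚP.*-identityˡ (x j))) (xy j ℓ<j j≤ℓ⊔v)))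
        (λ j ℓ⊔v<j j≤m → trans (cong (λ b → qj r j * (ind b * x j)) (declines v j (ℕP.≤-<-trans (ℕP.m≤n⊔m ℓ v) ℓ⊔v<j) j≤m))
                               (trans (cong (qj r j *_) (ℚP.*-zeroˡ (x j))) (ℚP.*-zeroʳ (qj r j))))

    noSale·Q : (1ℚ - saleProb) * Q ℓ ≡ Q (ℓ ⊔ v)
    noSale·Q = begin
        (1ℚ - saleProb) * Q ℓ
          ≡⟨ solve 2 (λ p q → (con 1ℚ :- p) :* q := q :- p :* q) refl saleProb (Q ℓ) ⟩
        Q ℓ - saleProb * Q ℓ
          ≡⟨ cong (λ z → Q ℓ - z) (trans (cong (_* Q ℓ) (E-cong (priceDist m r ℓ) (λ j → sym (ℚP.*-identityʳ _))))
                                   (trans (priceDist-E·Q ℓ ℓ<m _) (restrict (λ _ → 1ℚ) (qj r) (λ j _ _ → ℚP.*-identityʳ _)))) ⟩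
        Q ℓ - A
          ≡⟨ cong (λ z → z - A) (Q-split ℓ (ℓ ⊔ v) (ℕP.m≤m⊔n ℓ v) ℓ⊔v≤m) ⟩
        A + Q (ℓ ⊔ v) - A
          ≡⟨ solve 2 (λ a q → a :+ q :- a := q) refl A (Q (ℓ ⊔ v)) ⟩
        Q (ℓ ⊔ v) ∎
      where
      open ≡-Reasoning
      A = ∑⟨ ℓ , ℓ ⊔ v ] (qj r)

    saleRevenue·Q : saleRevenue * Q ℓ ≡ r (ℓ ⊔ v) - r ℓ
    saleRevenue·Q = trans (priceDist-E·Q ℓ ℓ<m _)
      (trans (restrict r (λ j → r j - r (j ∸ 1))
                (λ j ℓ<j j≤ℓ⊔v → q·r j (ℕP.≤-<-trans z≤n ℓ<j) (ℕP.≤-trans j≤ℓ⊔v ℓ⊔v≤m)))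
             (∑⟨⟩-telescope r (ℕP.m≤m⊔n ℓ v)))

E-bernoulli : {X : Set} (P : Dist ℕ) → E P (λ _ → 1ℚ) ≡ 1ℚ → (b : ℕ → Bool) (f : X → ℚ) (x y : X) →
              E P (λ j → f (if b j then x else y)) ≡
              E P (λ j → ind (b j)) * f x + (1ℚ - E P (λ j → ind (b j))) * f y
E-bernoulli P mass1 b f x y = begin
    E P (λ j → f (if b j then x else y))
      ≡⟨ E-cong P (λ j → pointwise (b j)) ⟩
    E P (λ j → f y * 1ℚ + (f x - f y) * ind (b j))
      ≡⟨ E-+ P _ _ ⟩
    E P (λ _ → f y * 1ℚ) + E P (λ j → (f x - f y) * ind (b j))
      ≡⟨ cong₂ _+_ (trans (E-* P (f y) _) (cong (f y *_) mass1)) (E-* P (f x - f y) _) ⟩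
    f y * 1ℚ + (f x - f y) * p
      ≡⟨ solve 3 (λ u w p → w :* con 1ℚ :+ (u :- w) :* p := p :* u :+ (con 1ℚ :- p) :* w) refl (f x) (f y) p ⟩
    p * f x + (1ℚ - p) * f y ∎
  where
  open ≡-Reasoning
  p = E P (λ j → ind (b j))
  pointwise : ∀ c → f (if c then x else y) ≡ f y * 1ℚ + (f x - f y) * ind c
  pointwise true  = solve 2 (λ u w → u := w :* con 1ℚ :+ (u :- w) :* con 1ℚ) refl (f x) (f y)
  pointwise false = solve 2 (λ u w → w := w :* con 1ℚ :+ (u :- w) :* con 0ℚ) refl (f x) (f y)

E-vtAtom : {X : Set} (f : X → ℚ) (P : Dist ℕ) (F : ℚ × ℕ → ℚ × X) (h : ℕ → X) (p : ℚ) (s : X) →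
           E P (λ _ → 1ℚ) ≡ 1ℚ → (∀ w j → F (w , j) ≡ (p * w , h j)) → ∀ b →
           E (if b then (p , s) ∷ [] else (if null P then (p , s) ∷ [] else map F P)) f ≡
           p * (if b then f s else E P (λ j → f (h j)))
E-vtAtom f P        F h p s mass1 shape true  = ℚP.+-identityʳ _
E-vtAtom f []       F h p s mass1 shape false = ⊥-elim (0ℚ≢1ℚ mass1)
E-vtAtom f (e ∷ P′) F h p s mass1 shape false = E-map (e ∷ P′) F p h f shape

E-vtAtom-idle : {X : Set} (f : X → ℚ) (P : Dist ℕ) (F : ℚ × ℕ → ℚ × X) (p : ℚ) (s : X) → P ≡ [] → ∀ b →
                E (if b then (p , s) ∷ [] else (if null P then (p , s) ∷ [] else map F P)) f ≡ p * f s
E-vtAtom-idle f .[] F p s refl true  = ℚP.+-identityʳ _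
E-vtAtom-idle f .[] F p s refl false = ℚP.+-identityʳ _

E-vt′Atom : {X : Set} (f : X → ℚ) (P : Dist ℕ) (F : ℚ × ℕ → ℚ × X) (h : ℕ → X) (p γ : ℚ) (x : X) →
            E P (λ _ → 1ℚ) ≡ 1ℚ → (∀ w j → F (w , j) ≡ (p * (1ℚ - γ) * w , h j)) →
            E (if null P then (p , x) ∷ [] else (p * γ , x) ∷ map F P) f ≡
            p * (γ * f x + (1ℚ - γ) * E P (λ j → f (h j)))
E-vt′Atom f []       F h p γ x mass1 shape = ⊥-elim (0ℚ≢1ℚ mass1)
E-vt′Atom f (e ∷ P′) F h p γ x mass1 shape = begin
    p * γ * f x + E (map F (e ∷ P′)) f
      ≡⟨ cong (p * γ * f x +_) (E-map (e ∷ P′) F (p * (1ℚ - γ)) h f shape) ⟩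
    p * γ * f x + p * (1ℚ - γ) * E (e ∷ P′) (λ j → f (h j))
      ≡⟨ solve 4 (λ p g a b → p :* g :* a :+ p :* (con 1ℚ :- g) :* b := p :* (g :* a :+ (con 1ℚ :- g) :* b))
                 refl p γ (f x) (E (e ∷ P′) (λ j → f (h j))) ⟩
    p * (γ * f x + (1ℚ - γ) * E (e ∷ P′) (λ j → f (h j))) ∎
  where open ≡-Reasoning

E-vt′Atom-idle : {X : Set} (f : X → ℚ) (P : Dist ℕ) (F : ℚ × ℕ → ℚ × X) (p γ : ℚ) (x : X) → P ≡ [] →
                 E (if null P then (p , x) ∷ [] else (p * γ , x) ∷ map F P) f ≡ p * f x
E-vt′Atom-idle f .[] F p γ x refl = ℚP.+-identityʳ _

module Coupling (m : ℕ) (r : ℕ → ℚ) (valid : ValidPrices m r) (k : ℕ) (0<k : 0 < k) (0<m : 0 < m) where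
  open PriceGrid m r valid
  open Slots k

  c* : ℚ
  c* = cstar m r

  record Coupled (lev : ℕ → ℕ) (D : Dist (ℕ → Bool)) (D′ : Dist (ℕ × ℚ)) : Set where
    field
      levels≤m      : ∀ i → lev i ≤ m
      nonneg        : NonNeg D
      sameInventory : ∀ (g : ℕ → ℚ) → E D′ (λ x → g (proj₁ x)) ≡ E D (λ s → g (inventory s))
      revenue       : E D′ proj₂ ≡ c* * ∑< k (λ i → r (lev i))
      unsold        : ∀ i → i < k → E D (λ s → ind (not (s i))) ≡ Q (lev i) * c*

  -- Q 0 · c* = 1: initially every slot is unsold
  Q0·c* : Q 0 * c* ≡ 1ℚ
  Q0·c* = ÷?-inverseʳ (Q 0) (λ e → ℚP.<-irrefl (sym e) (Q-pos 0 0<m))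

  initially : Coupled (λ _ → 0) ((1ℚ , (λ _ → false)) ∷ []) ((1ℚ , (k , 0ℚ)) ∷ [])
  initially = record
    { levels≤m      = λ _ → z≤n
    ; nonneg        = λ f f≥0 → subst (0ℚ ≤ℚ_) (sym (trans (ℚP.+-identityʳ _) (ℚP.*-identityˡ _))) (f≥0 _)
    ; sameInventory = λ g → cong (λ c → 1ℚ * g (k ∸ c) + 0ℚ) (sym count-none)
    ; revenue       = sym (trans (cong (c* *_) (∑<-vanish k _ (λ _ _ → proj₁ valid))) (ℚP.*-zeroʳ c*))
    ; unsold        = λ _ _ → sym Q0·c*
    }

  module Step (lev : ℕ → ℕ) (D : Dist (ℕ → Bool)) (D′ : Dist (ℕ × ℚ)) (inv : Coupled lev D D′)
              (v : ℕ) (v≤m : v ≤ m) where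
    open Coupled inv

    a : ℕ
    a = argmin k lev

    a<k : a < k
    a<k = argmin-< k lev 0<k

    ℓ : ℕ
    ℓ = lev a

    lev′ : ℕ → ℕ
    lev′ = stepLevels k lev v

    levels≤m′ : ∀ i → lev′ i ≤ m
    levels≤m′ i with i ≡ᵇ a
    ... | true  = ℕP.⊔-lub (levels≤m a) v≤m
    ... | false = levels≤m i

    invLaw soldAt unsoldAt : ℕ → ℚ
    invLaw   I = E D (λ s → ind (inventory s ≡ᵇ I))
    soldAt   I = E D (λ s → ind (s a) * ind (inventory s ≡ᵇ I))
    unsoldAt I = E D (λ s → ind (not (s a)) * ind (inventory s ≡ᵇ I))

    invLaw-split : ∀ I → invLaw I ≡ soldAt I + unsoldAt I
    invLaw-split I = trans (E-cong D (λ s → pointwise (s a) (ind (inventory s ≡ᵇ I)))) (E-+ D _ _)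
      where
      pointwise : ∀ b x → x ≡ ind b * x + ind (not b) * x
      pointwise true  x = solve 1 (λ x → x := con 1ℚ :* x :+ con 0ℚ :* x) refl x
      pointwise false x = solve 1 (λ x → x := con 0ℚ :* x :+ con 1ℚ :* x) refl x

    unsoldAt-zero : unsoldAt 0 ≡ 0ℚ
    unsoldAt-zero = trans (E-cong D pointwise) (E-0 D)
      where
      pointwise : ∀ s → ind (not (s a)) * ind (inventory s ≡ᵇ 0) ≡ 0ℚ
      pointwise s with s a in sa
      ... | true  = ℚP.*-zeroˡ (ind (inventory s ≡ᵇ 0))
      ... | false rewrite ≡ᵇ-false (inventory s) 0 (inventory-unsold s a a<k sa) = ℚP.*-zeroʳ 1ℚ

    γ : ℕ → ℚ
    γ I = gamma k a I D

    γ-eq : ∀ I → γ I ≡ soldAt I ÷? invLaw I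
    γ-eq I = cong₂ _÷?_
      (trans (mass-filter-E D _ (λ s → (inventory s ≡ᵇ I) ∧ s a) (λ _ _ → refl))
             (E-cong D (λ s → trans (ind-∧ (inventory s ≡ᵇ I) (s a)) (ℚP.*-comm (ind (inventory s ≡ᵇ I)) (ind (s a))))))
      (mass-filter-E D _ (λ s → inventory s ≡ᵇ I) (λ _ _ → refl))

    γ-weights : ∀ I → γ I * invLaw I ≡ soldAt I × (1ℚ - γ I) * invLaw I ≡ unsoldAt I
    γ-weights I with invLaw I ℚ.≟ 0ℚ
    ... | yes law≡0 =
          trans (cong (γ I *_) law≡0) (trans (ℚP.*-zeroʳ (γ I)) (sym sold≡0))
        , trans (cong ((1ℚ - γ I) *_) law≡0) (trans (ℚP.*-zeroʳ (1ℚ - γ I)) (sym unsold≡0))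
      where
      sold≥0 : 0ℚ ≤ℚ soldAt I
      sold≥0 = nonneg _ (λ s → *-nonneg (ind-nonneg (s a)) (ind-nonneg (inventory s ≡ᵇ I)))
      unsold≥0 : 0ℚ ≤ℚ unsoldAt I
      unsold≥0 = nonneg _ (λ s → *-nonneg (ind-nonneg (not (s a))) (ind-nonneg (inventory s ≡ᵇ I)))
      sold≡0 : soldAt I ≡ 0ℚ
      sold≡0 = nonneg-sum-zero sold≥0 unsold≥0 (trans (sym (invLaw-split I)) law≡0)
      unsold≡0 : unsoldAt I ≡ 0ℚ
      unsold≡0 = nonneg-sum-zero unsold≥0 sold≥0 (trans (ℚP.+-comm (unsoldAt I) (soldAt I)) (trans (sym (invLaw-split I)) law≡0))
    ... | no law≢0 = sold , notSold
      where
      open ≡-Reasoning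
      sold : γ I * invLaw I ≡ soldAt I
      sold = begin
        γ I * invLaw I                           ≡⟨ cong (_* invLaw I) (trans (γ-eq I) (÷?-as-* (soldAt I) (invLaw I))) ⟩
        soldAt I * (1ℚ ÷? invLaw I) * invLaw I    ≡⟨ solve 3 (λ n x y → n :* x :* y := n :* (y :* x)) refl (soldAt I) _ (invLaw I) ⟩
        soldAt I * (invLaw I * (1ℚ ÷? invLaw I))  ≡⟨ cong (soldAt I *_) (÷?-inverseʳ (invLaw I) law≢0) ⟩
        soldAt I * 1ℚ                            ≡⟨ ℚP.*-identityʳ _ ⟩
        soldAt I ∎
      notSold : (1ℚ - γ I) * invLaw I ≡ unsoldAt I
      notSold = begin
        (1ℚ - γ I) * invLaw I                    ≡⟨ solve 2 (λ g x → (con 1ℚ :- g) :* x := x :- g :* x) refl (γ I) (invLaw I) ⟩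
        invLaw I - γ I * invLaw I                ≡⟨ cong₂ _-_ (invLaw-split I) sold ⟩
        soldAt I + unsoldAt I - soldAt I          ≡⟨ solve 2 (λ x y → x :+ y :- x := y) refl (soldAt I) (unsoldAt I) ⟩
        unsoldAt I ∎

    -- VT′ at inventory I imitates the chosen slot: "sold" with probability γ I, "unsold" otherwise.
    mix : (Bool → ℕ → ℚ) → ℕ → ℚ
    mix F zero    = F true zero
    mix F (suc I) = γ (suc I) * F true (suc I) + (1ℚ - γ (suc I)) * F false (suc I)

    mix-weights : ∀ F I → mix F I * invLaw I ≡ F true I * soldAt I + F false I * unsoldAt I
    mix-weights F zero = begin
        F true 0 * invLaw 0                         ≡⟨ cong (F true 0 *_) (trans (invLaw-split 0) (cong (soldAt 0 +_) unsoldAt-zero)) ⟩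
        F true 0 * (soldAt 0 + 0ℚ)                  ≡⟨ solve 3 (λ x n y → x :* (n :+ con 0ℚ) := x :* n :+ y :* con 0ℚ) refl (F true 0) (soldAt 0) (F false 0) ⟩
        F true 0 * soldAt 0 + F false 0 * 0ℚ        ≡⟨ cong (λ z → F true 0 * soldAt 0 + F false 0 * z) (sym unsoldAt-zero) ⟩
        F true 0 * soldAt 0 + F false 0 * unsoldAt 0 ∎
      where open ≡-Reasoning
    mix-weights F (suc I) = begin
        (g * x + (1ℚ - g) * y) * M               ≡⟨ solve 4 (λ g x y M → (g :* x :+ (con 1ℚ :- g) :* y) :* M := x :* (g :* M) :+ y :* ((con 1ℚ :- g) :* M)) refl g x y M ⟩
        x * (g * M) + y * ((1ℚ - g) * M)          ≡⟨ cong₂ (λ p q → x * p + y * q) (proj₁ (γ-weights (suc I))) (proj₂ (γ-weights (suc I))) ⟩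
        x * soldAt (suc I) + y * unsoldAt (suc I) ∎
      where
      open ≡-Reasoning
      g = γ (suc I)
      x = F true (suc I)
      y = F false (suc I)
      M = invLaw (suc I)

    open Partition D inventory k (All.universal (λ e → inventory-≤ (proj₂ e)) D)

    -- the coupling identity: averaging VT′'s imitation over its inventory reproduces VT's slot a
    coupling : ∀ (F : Bool → ℕ → ℚ) → E D′ (λ x → mix F (proj₁ x)) ≡ E D (λ s → F (s a) (inventory s))
    coupling F = begin
        E D′ (λ x → mix F (proj₁ x))
          ≡⟨ sameInventory (mix F) ⟩
        E D (λ s → mix F (inventory s))
          ≡⟨ E-via-law (mix F) ⟩
        ∑< (suc k) (λ I → mix F I * invLaw I)
          ≡⟨ ∑<-cong (suc k) (λ I _ → trans (mix-weights F I) (sym (slice I))) ⟩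
        ∑< (suc k) (λ I → E D (λ s → F (s a) (inventory s) * ind (inventory s ≡ᵇ I)))
          ≡⟨ sym (E-partition _) ⟩
        E D (λ s → F (s a) (inventory s)) ∎
      where
      open ≡-Reasoning
      pointwise : ∀ b x I → F b x * ind (x ≡ᵇ I) ≡ F true I * (ind b * ind (x ≡ᵇ I)) + F false I * (ind (not b) * ind (x ≡ᵇ I))
      pointwise true  x I rewrite ind-subst (F true) x I =
        solve 3 (λ u w i → u :* i := u :* (con 1ℚ :* i) :+ w :* (con 0ℚ :* i)) refl (F true I) (F false I) (ind (x ≡ᵇ I))
      pointwise false x I rewrite ind-subst (F false) x I =
        solve 3 (λ u w i → w :* i := u :* (con 0ℚ :* i) :+ w :* (con 1ℚ :* i)) refl (F true I) (F false I) (ind (x ≡ᵇ I))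
      slice : ∀ I → E D (λ s → F (s a) (inventory s) * ind (inventory s ≡ᵇ I)) ≡ F true I * soldAt I + F false I * unsoldAt I
      slice I = trans (E-cong D (λ s → pointwise (s a) (inventory s) I))
                      (trans (E-+ D _ _) (cong₂ _+_ (E-* D (F true I) _) (E-* D (F false I) _)))

    pd : Dist ℕ
    pd = priceDist m r ℓ

    D₁ : Dist (ℕ → Bool)
    D₁ = vtStep m k r lev v D

    D₁′ : Dist (ℕ × ℚ)
    D₁′ = vtpStep m k r lev D v D′

    sell : (ℕ → Bool) → (ℕ → Bool)
    sell s = update s a true

    module Active (ℓ<m : ℓ < m) where
      open Sale ℓ v ℓ<m v≤m

      mass1 : E pd (λ _ → 1ℚ) ≡ 1ℚ
      mass1 = priceDist-mass ℓ ℓ<m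

      VT-step : ∀ f → E D₁ f ≡ E D (λ s → if s a then f s else E pd (λ j → f (if sells r v j then sell s else s)))
      VT-step f = E-concatMap D _ f _
        (λ p s → E-vtAtom f pd _ (λ j → if sells r v j then sell s else s) p s mass1 (λ _ _ → refl) (s a))

      VT-kernel : ∀ f → E D₁ f ≡ E D (λ s → if s a then f s else saleProb * f (sell s) + (1ℚ - saleProb) * f s)
      VT-kernel f = trans (VT-step f)
        (E-cong D (λ s → cong (λ z → if s a then f s else z) (E-bernoulli pd mass1 (sells r v) f (sell s) s)))

      vt′Kernel : (ℕ × ℚ → ℚ) → ℕ × ℚ → ℚ
      vt′Kernel f (zero  , rev) = f (zero , rev)
      vt′Kernel f (suc I , rev) = γ (suc I) * f (suc I , rev)
        + (1ℚ - γ (suc I)) * E pd (λ j → f (if sells r v j then (I , rev + r j) else (suc I , rev)))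

      VT′-step : ∀ f → E D₁′ f ≡ E D′ (vt′Kernel f)
      VT′-step f = E-concatMap D′ _ f (vt′Kernel f)
        (λ { p (zero , rev)  → ℚP.+-identityʳ _
           ; p (suc I , rev) → E-vt′Atom f pd _ (λ j → if sells r v j then (I , rev + r j) else (suc I , rev))
                                 p (γ (suc I)) (suc I , rev) mass1 (λ _ _ → refl) })

      nonneg′ : NonNeg D₁
      nonneg′ f f≥0 = subst (0ℚ ≤ℚ_) (sym (VT-step f))
        (nonneg _ (λ s → if-nonneg (s a) (f≥0 s) (priceDist-nonneg ℓ _ (λ j → f≥0 _))))

      sameInventory′ : ∀ (g : ℕ → ℚ) → E D₁′ (λ x → g (proj₁ x)) ≡ E D₁ (λ s → g (inventory s))
      sameInventory′ g = begin
          E D₁′ (λ x → g (proj₁ x))                   ≡⟨ VT′-step _ ⟩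
          E D′ (vt′Kernel (λ x → g (proj₁ x)))         ≡⟨ E-cong D′ imitation ⟩
          E D′ (λ x → mix F (proj₁ x))                 ≡⟨ coupling F ⟩
          E D (λ s → F (s a) (inventory s))            ≡⟨ E-cong D selling ⟩
          E D (λ s → if s a then g (inventory s)
                     else saleProb * g (inventory (sell s)) + (1ℚ - saleProb) * g (inventory s))
                                                       ≡⟨ sym (VT-kernel _) ⟩
          E D₁ (λ s → g (inventory s)) ∎
        where
        open ≡-Reasoning
        F : Bool → ℕ → ℚ
        F true  I = g I
        F false I = saleProb * g (ℕ.pred I) + (1ℚ - saleProb) * g I
        imitation : ∀ x → vt′Kernel (λ x → g (proj₁ x)) x ≡ mix F (proj₁ x)
        imitation (zero  , rev) = refl
        imitation (suc I , rev) = cong (λ z → γ (suc I) * g (suc I) + (1ℚ - γ (suc I)) * z)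
          (trans (E-cong pd (λ j → cong g (if-float proj₁ (sells r v j))))
                 (E-bernoulli pd mass1 (sells r v) g I (suc I)))
        selling : ∀ s → F (s a) (inventory s) ≡
                  (if s a then g (inventory s) else saleProb * g (inventory (sell s)) + (1ℚ - saleProb) * g (inventory s))
        selling s with s a in sa
        ... | true  = refl
        ... | false = cong (λ z → saleProb * g z + (1ℚ - saleProb) * g (inventory s)) (sym (inventory-sell s a a<k sa))

      levels-sum′ : ∑< k (λ i → r (lev′ i)) ≡ ∑< k (λ i → r (lev i)) + (r (ℓ ⊔ v) - r ℓ)
      levels-sum′ = trans
        (∑<-update k a (λ i → r (lev i)) (λ i → r (lev′ i)) a<k (λ j j≢a → cong r (update-other lev a (ℓ ⊔ v) j j≢a)))
        (cong (λ z → ∑< k (λ i → r (lev i)) + (r z - r ℓ)) (update-same lev a (ℓ ⊔ v)))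

      revenue′ : E D₁′ proj₂ ≡ c* * ∑< k (λ i → r (lev′ i))
      revenue′ = begin
          E D₁′ proj₂                                              ≡⟨ VT′-step proj₂ ⟩
          E D′ (vt′Kernel proj₂)                                   ≡⟨ E-cong D′ gain ⟩
          E D′ (λ x → proj₂ x + saleRevenue * mix Fᵤ (proj₁ x))     ≡⟨ E-+ D′ _ _ ⟩
          E D′ proj₂ + E D′ (λ x → saleRevenue * mix Fᵤ (proj₁ x))  ≡⟨ cong₂ _+_ revenue (E-* D′ saleRevenue _) ⟩
          c* * Σ + saleRevenue * E D′ (λ x → mix Fᵤ (proj₁ x))      ≡⟨ cong (λ z → c* * Σ + saleRevenue * z) (trans (coupling Fᵤ) (unsold a a<k)) ⟩
          c* * Σ + saleRevenue * (Q ℓ * c*)                        ≡⟨ solve 4 (λ c s w q → c :* s :+ w :* (q :* c) := c :* (s :+ w :* q)) refl c* Σ saleRevenue (Q ℓ) ⟩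
          c* * (Σ + saleRevenue * Q ℓ)                             ≡⟨ cong (λ z → c* * (Σ + z)) saleRevenue·Q ⟩
          c* * (Σ + (r (ℓ ⊔ v) - r ℓ))                             ≡⟨ cong (c* *_) (sym levels-sum′) ⟩
          c* * ∑< k (λ i → r (lev′ i)) ∎
        where
        open ≡-Reasoning
        Σ = ∑< k (λ i → r (lev i))
        -- VT′ gains revenue exactly when it imitates an unsold slot and a sale happens
        Fᵤ : Bool → ℕ → ℚ
        Fᵤ b _ = ind (not b)
        offer : ∀ I rev → E pd (λ j → proj₂ (if sells r v j then (I , rev + r j) else (suc I , rev))) ≡ rev + saleRevenue
        offer I rev = begin
            E pd (λ j → proj₂ (if sells r v j then (I , rev + r j) else (suc I , rev)))
              ≡⟨ E-cong pd (λ j → pointwise (sells r v j) (r j)) ⟩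
            E pd (λ j → rev * 1ℚ + ind (sells r v j) * r j)
              ≡⟨ E-+ pd _ _ ⟩
            E pd (λ _ → rev * 1ℚ) + saleRevenue
              ≡⟨ cong (_+ saleRevenue) (trans (E-* pd rev _) (trans (cong (rev *_) mass1) (ℚP.*-identityʳ rev))) ⟩
            rev + saleRevenue ∎
          where
          pointwise : ∀ b x → proj₂ (if b then (I , rev + x) else (suc I , rev)) ≡ rev * 1ℚ + ind b * x
          pointwise true  x = solve 2 (λ r x → r :+ x := r :* con 1ℚ :+ con 1ℚ :* x) refl rev x
          pointwise false x = solve 2 (λ r x → r := r :* con 1ℚ :+ con 0ℚ :* x) refl rev x
        gain : ∀ x → vt′Kernel proj₂ x ≡ proj₂ x + saleRevenue * mix Fᵤ (proj₁ x)
        gain (zero  , rev) = solve 2 (λ r w → r := r :+ w :* con 0ℚ) refl rev saleRevenue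
        gain (suc I , rev) = trans (cong (λ z → γ (suc I) * rev + (1ℚ - γ (suc I)) * z) (offer I rev))
          (solve 3 (λ g r w → g :* r :+ (con 1ℚ :- g) :* (r :+ w) := r :+ w :* (g :* con 0ℚ :+ (con 1ℚ :- g) :* con 1ℚ))
                 refl (γ (suc I)) rev saleRevenue)

      unsold′ : ∀ i → i < k → E D₁ (λ s → ind (not (s i))) ≡ Q (lev′ i) * c*
      unsold′ i i<k with i ℕ.≟ a
      ... | yes refl = begin
          E D₁ (λ s → ind (not (s a)))                    ≡⟨ VT-kernel _ ⟩
          E D (λ s → if s a then ind (not (s a)) else saleProb * ind (not (sell s a)) + (1ℚ - saleProb) * ind (not (s a)))
                                                          ≡⟨ E-cong D (λ s → pointwise s (s a) refl) ⟩
          E D (λ s → (1ℚ - saleProb) * ind (not (s a)))   ≡⟨ E-* D (1ℚ - saleProb) _ ⟩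
          (1ℚ - saleProb) * E D (λ s → ind (not (s a)))   ≡⟨ cong ((1ℚ - saleProb) *_) (unsold a a<k) ⟩
          (1ℚ - saleProb) * (Q ℓ * c*)                    ≡⟨ sym (ℚP.*-assoc (1ℚ - saleProb) (Q ℓ) c*) ⟩
          (1ℚ - saleProb) * Q ℓ * c*                      ≡⟨ cong (_* c*) noSale·Q ⟩
          Q (ℓ ⊔ v) * c*                                  ≡⟨ cong (λ z → Q z * c*) (sym (update-same lev a (ℓ ⊔ v))) ⟩
          Q (lev′ a) * c* ∎
        where
        open ≡-Reasoning
        pointwise : ∀ s b → s a ≡ b →
          (if b then ind (not b) else saleProb * ind (not (sell s a)) + (1ℚ - saleProb) * ind (not b)) ≡
          (1ℚ - saleProb) * ind (not b)
        pointwise s true  _ = sym (ℚP.*-zeroʳ (1ℚ - saleProb))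
        pointwise s false _ rewrite update-same s a true =
          solve 1 (λ p → p :* con 0ℚ :+ (con 1ℚ :- p) :* con 1ℚ := (con 1ℚ :- p) :* con 1ℚ) refl saleProb
      ... | no i≢a = begin
          E D₁ (λ s → ind (not (s i)))                    ≡⟨ VT-kernel _ ⟩
          E D (λ s → if s a then ind (not (s i)) else saleProb * ind (not (sell s i)) + (1ℚ - saleProb) * ind (not (s i)))
                                                          ≡⟨ E-cong D (λ s → pointwise s (s a)) ⟩
          E D (λ s → ind (not (s i)))                     ≡⟨ unsold i i<k ⟩
          Q (lev i) * c*                                  ≡⟨ cong (λ z → Q z * c*) (sym (update-other lev a (ℓ ⊔ v) i i≢a)) ⟩
          Q (lev′ i) * c* ∎
        where
        open ≡-Reasoning
        pointwise : ∀ s b →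
          (if b then ind (not (s i)) else saleProb * ind (not (sell s i)) + (1ℚ - saleProb) * ind (not (s i))) ≡ ind (not (s i))
        pointwise s true  = refl
        pointwise s false rewrite update-other s a true i i≢a =
          solve 2 (λ x p → p :* x :+ (con 1ℚ :- p) :* x := x) refl (ind (not (s i))) saleProb

      preserved : Coupled lev′ D₁ D₁′
      preserved = record
        { levels≤m = levels≤m′ ; nonneg = nonneg′ ; sameInventory = sameInventory′
        ; revenue = revenue′ ; unsold = unsold′ }

    module Idle (ℓ≡m : ℓ ≡ m) where

      pd-empty : pd ≡ []
      pd-empty = trans (cong (priceDist m r) ℓ≡m) priceDist-top

      VT-idle : ∀ f → E D₁ f ≡ E D f
      VT-idle f = E-concatMap D _ f f (λ p s → E-vtAtom-idle f pd _ p s pd-empty (s a))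

      VT′-idle : ∀ f → E D₁′ f ≡ E D′ f
      VT′-idle f = E-concatMap D′ _ f f
        (λ { p (zero , rev)  → ℚP.+-identityʳ _
           ; p (suc I , rev) → E-vt′Atom-idle f pd _ p (γ (suc I)) (suc I , rev) pd-empty })

      lev′≡lev : ∀ i → lev′ i ≡ lev i
      lev′≡lev i with i ≡ᵇ a in i≡a
      ... | true  = trans (ℕP.m≥n⇒m⊔n≡m (subst (v ≤_) (sym ℓ≡m) v≤m)) (cong lev (sym (≡ᵇ-true i a i≡a)))
      ... | false = refl

      preserved : Coupled lev′ D₁ D₁′
      preserved = record
        { levels≤m      = levels≤m′
        ; nonneg        = λ f f≥0 → subst (0ℚ ≤ℚ_) (sym (VT-idle f)) (nonneg f f≥0)
        ; sameInventory = λ g → trans (VT′-idle _) (trans (sameInventory g) (sym (VT-idle _)))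
        ; revenue       = trans (VT′-idle proj₂) (trans revenue (cong (c* *_) (∑<-cong k (λ i _ → cong r (sym (lev′≡lev i))))))
        ; unsold        = λ i i<k → trans (VT-idle _) (trans (unsold i i<k) (cong (λ z → Q z * c*) (sym (lev′≡lev i))))
        }

    preserved : Coupled lev′ D₁ D₁′
    preserved with ℕP.m≤n⇒m<n∨m≡n (levels≤m a)
    ... | inj₁ ℓ<m = Active.preserved ℓ<m
    ... | inj₂ ℓ≡m = Idle.preserved ℓ≡m

  CoupledState : RunState → Set
  CoupledState (st lev D D′) = Coupled lev D D′

  run : ∀ (vs : List ℕ) (σ : RunState) → All (_≤ m) vs → CoupledState σ → CoupledState (foldl (runStep m k r) σ vs)
  run []       σ              _          coupled = coupled
  run (v ∷ vs) (st lev D D′) (v≤m ∷ vs≤m) coupled = run vs _ vs≤m (Step.preserved lev D D′ coupled v v≤m)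

module ListSums where

  ∑ : (ℚ → ℚ) → List ℚ → ℚ
  ∑ f ys = sumℚ (map f ys)

  ∑-∑< : ∀ (ys : List ℚ) n (F : ℕ → ℚ → ℚ) → ∑ (λ y → ∑< n (λ i → F i y)) ys ≡ ∑< n (λ i → ∑ (F i) ys)
  ∑-∑< []       n F = sym (∑<-vanish n (λ _ → 0ℚ) (λ _ _ → refl))
  ∑-∑< (y ∷ ys) n F rewrite ∑-∑< ys n F = sym (∑<-+ n (λ i → F i y) (λ i → ∑ (F i) ys))

  ∑-* : ∀ (ys : List ℚ) c (g : ℚ → ℚ) → ∑ (λ y → c * g y) ys ≡ c * ∑ g ys
  ∑-* []       c g = sym (ℚP.*-zeroʳ c)
  ∑-* (y ∷ ys) c g rewrite ∑-* ys c g = sym (ℚP.*-distribˡ-+ c (g y) _)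

  ∑-congAll : ∀ {ys : List ℚ} {f g : ℚ → ℚ} → All (λ y → f y ≡ g y) ys → ∑ f ys ≡ ∑ g ys
  ∑-congAll []       = refl
  ∑-congAll (e ∷ es) = cong₂ _+_ e (∑-congAll es)

  ∑-↭ : ∀ (f : ℚ → ℚ) {xs ys} → xs Perm.↭ ys → ∑ f xs ≡ ∑ f ys
  ∑-↭ f Perm.refl         = refl
  ∑-↭ f (Perm.prep x p)   = cong (f x +_) (∑-↭ f p)
  ∑-↭ f {x ∷ y ∷ xs} {.y ∷ .x ∷ ys} (Perm.swap .x .y p) rewrite ∑-↭ f p =
    solve 3 (λ a b c → a :+ (b :+ c) := b :+ (a :+ c)) refl (f x) (f y) (∑ f ys)
  ∑-↭ f (Perm.trans p q)  = trans (∑-↭ f p) (∑-↭ f q)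

  ∑-take-≤ : ∀ (f : ℚ → ℚ) → (∀ y → 0ℚ ≤ℚ f y) → ∀ n (ys : List ℚ) → ∑ f (take n ys) ≤ℚ ∑ f ys
  ∑-take-≤ f f≥0 zero    ys       = nonneg ys
    where
    nonneg : ∀ ys → 0ℚ ≤ℚ ∑ f ys
    nonneg []       = ℚP.≤-refl
    nonneg (y ∷ ys) = ℚP.+-mono-≤ (f≥0 y) (nonneg ys)
  ∑-take-≤ f f≥0 (suc n) []       = ℚP.≤-refl
  ∑-take-≤ f f≥0 (suc n) (y ∷ ys) = ℚP.+-monoʳ-≤ (f y) (∑-take-≤ f f≥0 n ys)

  ∑-take-≤-length : ∀ (f : ℚ → ℚ) → (∀ y → 0ℚ ≤ℚ f y) → (∀ y → f y ≤ℚ 1ℚ) → ∀ n (ys : List ℚ) →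
                    ∑ f (take n ys) ≤ℚ ∑< n (λ _ → 1ℚ)
  ∑-take-≤-length f f≥0 f≤1 zero    ys       = ℚP.≤-refl
  ∑-take-≤-length f f≥0 f≤1 (suc n) []       = ∑<-nonneg (suc n) _ (λ _ _ → ind-nonneg true)
  ∑-take-≤-length f f≥0 f≤1 (suc n) (y ∷ ys) = ℚP.+-mono-≤ (f≤1 y) (∑-take-≤-length f f≥0 f≤1 n ys)

  All-take : ∀ {P : ℚ → Set} n {ys : List ℚ} → All P ys → All P (take n ys)
  All-take zero    _        = []
  All-take (suc n) []       = []
  All-take (suc n) (p ∷ ps) = p ∷ All-take n ps

-- Layer-cake: a value r^{(v)} is
-- Σ_{j≤m} (r^{(j)} - r^{(j-1)}) 1[r^{(v)} ≥ r^{(j)}], and for every threshold r^{(j)} VT's levels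
-- reach it in at least min(k, #{t : V_t ≥ r^{(j)}}) slots.
module OptBound (m : ℕ) (r : ℕ → ℚ) (valid : ValidPrices m r) (k : ℕ) (0<k : 0 < k) where
  open PriceGrid m r valid
  open ListSums

  atLeast : ℕ → ℚ → ℚ
  atLeast j y = ind (does (r j ℚ.≤? y))

  atLeast-nonneg : ∀ j y → 0ℚ ≤ℚ atLeast j y
  atLeast-nonneg j y = ind-nonneg (does (r j ℚ.≤? y))

  atLeast-≤1 : ∀ j y → atLeast j y ≤ℚ 1ℚ
  atLeast-≤1 j y = ind-≤1 (does (r j ℚ.≤? y))
    where
    ind-≤1 : ∀ b → ind b ≤ℚ 1ℚ
    ind-≤1 true  = ℚP.≤-refl
    ind-≤1 false = ind-nonneg true

  atLeast-mono : ∀ j {y y′} → y ≤ℚ y′ → atLeast j y ≤ℚ atLeast j y′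
  atLeast-mono j {y} {y′} y≤y′ = ind-dec-mono (r j ℚ.≤? y) (r j ℚ.≤? y′) (λ rj≤y → ℚP.≤-trans rj≤y y≤y′)
    where
    ind-dec-mono : ∀ {P P′ : Set} (d : Dec P) (d′ : Dec P′) → (P → P′) → ind (does d) ≤ℚ ind (does d′)
    ind-dec-mono (yes _) (yes _) _ = ℚP.≤-refl
    ind-dec-mono (yes p) (no ¬q) f = ⊥-elim (¬q (f p))
    ind-dec-mono (no _)  d′      _ = ind-nonneg (does d′)

  atLeast-level : ∀ j x → j ≤ x → x ≤ m → atLeast j (r x) ≡ 1ℚ
  atLeast-level j x j≤x x≤m = cong ind (buys x j j≤x x≤m)

  atLeast-below : ∀ j x → x < j → j ≤ m → atLeast j (r x) ≡ 0ℚ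
  atLeast-below j x x<j j≤m = cong ind (declines x j x<j j≤m)

  layers : ℚ → ℚ
  layers y = ∑⟨ 0 , m ] (λ j → (r j - r (j ∸ 1)) * atLeast j y)

  layers-r : ∀ v → v ≤ m → layers (r v) ≡ r v
  layers-r v v≤m = begin
      layers (r v)
        ≡⟨ ∑⟨⟩-restrict {a = 0} _ (λ j → r j - r (j ∸ 1)) v≤m
             (λ j _ j≤v → trans (cong ((r j - r (j ∸ 1)) *_) (atLeast-level j v j≤v v≤m)) (ℚP.*-identityʳ _))
             (λ j v<j j≤m → trans (cong ((r j - r (j ∸ 1)) *_) (atLeast-below j v v<j j≤m)) (ℚP.*-zeroʳ (r j - r (j ∸ 1)))) ⟩
      ∑⟨ 0 , v ] (λ j → r j - r (j ∸ 1)) ≡⟨ ∑⟨⟩-telescope r z≤n ⟩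
      r v - r 0                         ≡⟨ cong (λ z → r v - z) (proj₁ valid) ⟩
      r v - 0ℚ                          ≡⟨ solve 1 (λ x → x :- con 0ℚ := x) refl (r v) ⟩
      r v ∎
    where open ≡-Reasoning

  capacity : ℚ
  capacity = ∑< k (λ _ → 1ℚ)

  slotsAtLeast : ℕ → (ℕ → ℕ) → ℚ
  slotsAtLeast j lev = ∑< k (λ t → atLeast j (r (lev t)))

  slotsAtLeast-≤ : ∀ j lev → slotsAtLeast j lev ≤ℚ capacity
  slotsAtLeast-≤ j lev = ∑<-mono k _ _ (λ t _ → atLeast-≤1 j (r (lev t)))

  -- the levels cover the counts c j = #{valuations ≥ r^{(j)}}, up to capacity
  Covers : (ℕ → ℕ) → (ℕ → ℚ) → Set
  Covers lev c = (∀ t → lev t ≤ m) × (∀ j → j ≤ m → c j ≤ℚ slotsAtLeast j lev ⊎ slotsAtLeast j lev ≡ capacity)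

  Covers-cong : ∀ lev {c c′} → (∀ j → c′ j ≡ c j) → Covers lev c → Covers lev c′
  Covers-cong lev eq (bounded , covers) = bounded , λ j j≤m → cast j (covers j j≤m)
    where
    cast : ∀ j → _ ⊎ _ → _
    cast j (inj₁ c≤) = inj₁ (subst (_≤ℚ slotsAtLeast j lev) (sym (eq j)) c≤)
    cast j (inj₂ full) = inj₂ full

  Covers-step : ∀ lev c v → v ≤ m → Covers lev c → Covers (stepLevels k lev v) (λ j → c j + atLeast j (r v))
  Covers-step lev c v v≤m (bounded , covers) = bounded′ , covers′
    where
    a = argmin k lev
    ℓ = lev a
    lev′ = stepLevels k lev v
    ℓ⊔v≤m : ℓ ⊔ v ≤ m
    ℓ⊔v≤m = ℕP.⊔-lub (bounded a) v≤m
    bounded′ : ∀ t → lev′ t ≤ m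
    bounded′ t with t ≡ᵇ a
    ... | true  = ℓ⊔v≤m
    ... | false = bounded t
    raised : ∀ t → lev t ≤ lev′ t
    raised t with t ≡ᵇ a in t≡a
    ... | true  = subst (λ z → lev z ≤ ℓ ⊔ v) (sym (≡ᵇ-true t a t≡a)) (ℕP.m≤m⊔n ℓ v)
    ... | false = ℕP.≤-refl
    more : ∀ j → slotsAtLeast j lev ≤ℚ slotsAtLeast j lev′
    more j = ∑<-mono k _ _ (λ t _ → atLeast-mono j (r-mono (lev t) (lev′ t) (raised t) (bounded′ t)))
    covers′ : ∀ j → j ≤ m → c j + atLeast j (r v) ≤ℚ slotsAtLeast j lev′ ⊎ slotsAtLeast j lev′ ≡ capacity
    covers′ j j≤m with j ℕ.≤? v
    covers′ j j≤m | no j≰v rewrite atLeast-below j v (ℕP.≰⇒> j≰v) j≤m with covers j j≤m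
    ... | inj₁ c≤ = inj₁ (subst (_≤ℚ slotsAtLeast j lev′) (sym (ℚP.+-identityʳ (c j))) (ℚP.≤-trans c≤ (more j)))
    ... | inj₂ full = inj₂ (ℚP.≤-antisym (slotsAtLeast-≤ j lev′) (subst (_≤ℚ slotsAtLeast j lev′) full (more j)))
    covers′ j j≤m | yes j≤v rewrite atLeast-level j v j≤v v≤m with j ℕ.≤? ℓ
    ... | yes j≤ℓ = inj₂ (∑<-cong k (λ t t<k → atLeast-level j (lev′ t)
                     (ℕP.≤-trans j≤ℓ (ℕP.≤-trans (argmin-min k lev t t<k) (raised t))) (bounded′ t)))
    ... | no j≰ℓ = add-one (covers j j≤m)
      where
      -- slot a moves from below r^{(j)} to at least r^{(j)}
      one-more : slotsAtLeast j lev′ ≡ slotsAtLeast j lev + (1ℚ - 0ℚ)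
      one-more = trans (∑<-update k a _ _ (argmin-< k lev 0<k)
                          (λ t t≢a → cong (λ z → atLeast j (r z)) (update-other lev a (ℓ ⊔ v) t t≢a)))
        (cong₂ (λ x y → slotsAtLeast j lev + (x - y))
           (trans (cong (λ z → atLeast j (r z)) (update-same lev a (ℓ ⊔ v)))
                  (atLeast-level j (ℓ ⊔ v) (ℕP.≤-trans j≤v (ℕP.m≤n⊔m ℓ v)) ℓ⊔v≤m))
           (atLeast-below j ℓ (ℕP.≰⇒> j≰ℓ) j≤m))
      add-one : c j ≤ℚ slotsAtLeast j lev ⊎ slotsAtLeast j lev ≡ capacity →
                c j + 1ℚ ≤ℚ slotsAtLeast j lev′ ⊎ slotsAtLeast j lev′ ≡ capacity
      add-one (inj₁ c≤) = inj₁ (subst (c j + 1ℚ ≤ℚ_) (sym one-more) (ℚP.+-monoˡ-≤ (1ℚ - 0ℚ) c≤))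
      add-one (inj₂ full) = ⊥-elim (ℚP.<-irrefl refl (ℚP.<-≤-trans (ℚP.<-≤-trans
        (subst (_<ℚ capacity + 1ℚ) (ℚP.+-identityʳ capacity) (ℚP.+-monoʳ-< capacity (ℚP.positive⁻¹ 1ℚ)))
        (ℚP.≤-reflexive (sym (trans one-more (cong (_+ (1ℚ - 0ℚ)) full)))))
        (slotsAtLeast-≤ j lev′)))

  run : ∀ (vs : List ℕ) (σ : RunState) (c : ℕ → ℚ) → All (_≤ m) vs → Covers (RunState.levels σ) c →
        Covers (RunState.levels (foldl (runStep m k r) σ vs)) (λ j → c j + ∑ (atLeast j) (map r vs))
  run []       σ c _ cov = Covers-cong _ (λ j → ℚP.+-identityʳ (c j)) cov
  run (v ∷ vs) (st lev D D′) c (v≤m ∷ vs≤m) cov =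
    Covers-cong _ (λ j → sym (ℚP.+-assoc (c j) (atLeast j (r v)) (∑ (atLeast j) (map r vs))))
      (run vs (runStep m k r (st lev D D′) v) (λ j → c j + atLeast j (r v)) vs≤m (Covers-step lev c v v≤m cov))

  Covers-initially : Covers (λ _ → 0) (λ _ → 0ℚ)
  Covers-initially = (λ _ → z≤n) , (λ j _ → inj₁ (∑<-nonneg k _ (λ t _ → atLeast-nonneg j (r 0))))

  top-k-≤ : ∀ (vs : List ℕ) (lev : ℕ → ℕ) → All (_≤ m) vs → Covers lev (λ j → 0ℚ + ∑ (atLeast j) (map r vs)) →
            sumℚ (take k (reverse (sort (map r vs)))) ≤ℚ ∑< k (λ t → r (lev t))
  top-k-≤ vs lev vs≤m (bounded , covers) = begin
      sumℚ zs                                          ≡⟨ cong sumℚ (sym (map-id zs)) ⟩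
      ∑ (λ y → y) zs                                   ≡⟨ ∑-congAll (All.map (λ { (v , v≤m , refl) → sym (layers-r v v≤m) }) onGrid) ⟩
      ∑ layers zs                                      ≡⟨ ∑-∑< zs m (λ i y → Δ i * atLeast (suc i) y) ⟩
      ∑< m (λ i → ∑ (λ y → Δ i * atLeast (suc i) y) zs) ≡⟨ ∑<-cong m (λ i _ → ∑-* zs (Δ i) (atLeast (suc i))) ⟩
      ∑< m (λ i → Δ i * ∑ (atLeast (suc i)) zs)        ≤⟨ ∑<-mono m _ _ (λ i i<m → ℚP.*-monoˡ-≤-nonNeg (Δ i) {{ℚ.nonNegative (Δ≥0 i i<m)}} (top-counts (suc i) i<m)) ⟩
      ∑< m (λ i → Δ i * slotsAtLeast (suc i) lev)      ≡⟨ ∑<-cong m (λ i _ → sym (∑<-* k (Δ i) _)) ⟩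
      ∑< m (λ i → ∑< k (λ t → Δ i * atLeast (suc i) (r (lev t)))) ≡⟨ sym (∑<-swap k m _) ⟩
      ∑< k (λ t → layers (r (lev t)))                  ≡⟨ ∑<-cong k (λ t _ → layers-r (lev t) (bounded t)) ⟩
      ∑< k (λ t → r (lev t)) ∎
    where
    open ℚP.≤-Reasoning
    Δ : ℕ → ℚ
    Δ i = r (suc i) - r i
    Δ≥0 : ∀ i → i < m → 0ℚ ≤ℚ Δ i
    Δ≥0 i i<m = diff-nonneg (r-mono i (suc i) (ℕP.n≤1+n i) i<m)
    ys = reverse (sort (map r vs))
    zs = take k ys
    sorted : ys Perm.↭ map r vs
    sorted = Perm.trans (↭-reverse (sort (map r vs))) (sort-↭ (map r vs))
    OnGrid : ℚ → Set
    OnGrid y = ∃ λ v → v ≤ m × y ≡ r v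
    onGrid : All OnGrid zs
    onGrid = All-take k (All-resp-↭ (Perm.↭-sym sorted) (grid vs≤m))
      where
      grid : ∀ {us : List ℕ} → All (_≤ m) us → All OnGrid (map r us)
      grid []                = []
      grid {u ∷ _} (u≤m ∷ ps) = (u , u≤m , refl) ∷ grid ps
    top-counts : ∀ j → j ≤ m → ∑ (atLeast j) zs ≤ℚ slotsAtLeast j lev
    top-counts j j≤m with covers j j≤m
    ... | inj₁ c≤ = ℚP.≤-trans (∑-take-≤ (atLeast j) (atLeast-nonneg j) k ys)
                      (ℚP.≤-trans (ℚP.≤-reflexive (∑-↭ (atLeast j) sorted))
                        (subst (_≤ℚ slotsAtLeast j lev) (ℚP.+-identityˡ _) c≤))
    ... | inj₂ full = subst (∑ (atLeast j) zs ≤ℚ_) (sym full) (∑-take-≤-length (atLeast j) (atLeast-nonneg j) (atLeast-≤1 j) k ys)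

finalLevels : (m k : ℕ) (r : ℕ → ℚ) {T : ℕ} → Vec (Fin (suc m)) T → ℕ → ℕ
finalLevels m k r V = RunState.levels (foldl (runStep m k r) (initState k) (valIndices V))

valIndices-≤ : ∀ {m T} (V : Vec (Fin (suc m)) T) → All (_≤ m) (valIndices V)
valIndices-≤ V = AllP.map⁺ (All.universal FinP.toℕ≤pred[n] (Vec.toList V))

expectedALG-levels : ∀ m r → ValidPrices m r → ∀ k → 0 < k → 0 < m → ∀ {T} (V : Vec (Fin (suc m)) T) →
                     expectedALG m k r V ≡ cstar m r * ∑< k (λ i → r (finalLevels m k r V i))
expectedALG-levels m r valid k 0<k 0<m V = trans
  (sumℚ-map-E (RunState.vtpDist σ) _ proj₂ (λ _ _ → refl))
  (Coupled.revenue (run (valIndices V) (initState k) (valIndices-≤ V) initially))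
  where
  open Coupling m r valid k 0<k 0<m
  σ = foldl (runStep m k r) (initState k) (valIndices V)

OPT-≤-levels : ∀ m r → ValidPrices m r → ∀ k → 0 < k → ∀ {T} (V : Vec (Fin (suc m)) T) →
               OPT m k r V ≤ℚ ∑< k (λ i → r (finalLevels m k r V i))
OPT-≤-levels m r valid k 0<k V =
  top-k-≤ (valIndices V) _ (valIndices-≤ V) (run (valIndices V) (initState k) (λ _ → 0ℚ) (valIndices-≤ V) Covers-initially)
  where open OptBound m r valid k 0<k

theorem2 : (m : ℕ) → 1 ≤ m → (r : ℕ → ℚ) → ValidPrices m r →
           (k : ℕ) → 1 ≤ k → (T : ℕ) → 1 ≤ T → (V : Vec (Fin (suc m)) T) →
           cstar m r * OPT m k r V ≤ℚ expectedALG m k r V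
theorem2 m 1≤m r valid k 1≤k T _ V = begin
    cstar m r * OPT m k r V                        ≤⟨ ℚP.*-monoˡ-≤-nonNeg (cstar m r) {{ℚ.nonNegative c*≥0}} (OPT-≤-levels m r valid k 1≤k V) ⟩
    cstar m r * ∑< k (λ i → r (finalLevels m k r V i)) ≡⟨ sym (expectedALG-levels m r valid k 1≤k 1≤m V) ⟩
    expectedALG m k r V ∎
  where
  open ℚP.≤-Reasoning
  c*≥0 : 0ℚ ≤ℚ cstar m r
  c*≥0 = 1÷?-nonneg (PriceGrid.Q m r valid 0) (PriceGrid.Q-nonneg m r valid 0)
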